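{- Let $\mathcal{S}=\{p_1,\dots,p_k\}$ be a reduced set of patterns with lengths $\ell_1,\dots,\ell_k$ and orbit sizes $r_1,\dots,r_k$. Let $\mathcal{A}(n,\mathcal{S})$ be the number of words (not patterns) of length $n$ over $\mathcal{A}$ that contain no factor belonging to any of the orbits $p_1,\dots,p_k$, and let $\mathcal{T}_{p_i}(n,\mathcal{S})$ be the number of words of length $n$ containing no factor belonging to any of these orbits except for a single occurrence of a word of the orbit $p_i$ at the very end. Put $\mathcal{G}(z)=\sum_{n\ge0}\mathcal{A}(n,\mathcal{S})z^n$ and $\mathcal{G}_{p_i}(z)=\sum_{n\ge0}\mathcal{T}_{p_i}(n,\mathcal{S})z^n$. Then $$(1-qz)\mathcal{G}(z)+\mathcal{G}_{p_1}(z)+\dots+\mathcal{G}_{p_k}(z)=1,$$ and for each $j=1,\dots,k$, $$\mathcal{G}(z)-\frac{1}{r_1}z^{ -\ell_1}\mathcal{C}_{p_1,p_j}(z)\mathcal{G}_{p_1}(z)-\dots-\frac{1}{r_k}z^{ -\ell_k}\mathcal{C}_{p_k,p_j}(z)\mathcal{G}_{p_k}(z)=0.$$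
   Context: Let $\mathcal{A}$ be a finite alphabet with $q\ge 2$ letters and $G$ a subgroup of the symmetric group on $\mathcal{A}$, acting on words letterwise. Words $v,w$ are equivalent ($v\sim w$) if they lie in the same $G$-orbit. A pattern is a $G$-orbit of words, represented by its lexicographically least word; lengths, letters and substrings $p(i,j)=p(i)p(i+1)\cdots p(j)$ of a pattern refer to this representative. $G_w$ denotes the stabilizer of a word $w$; equivalent words have equal stabilizers, so $G_p$ is defined for a pattern $p$, and the orbit size of $p$ is $r=|G|/|G_p|$. For patterns $p$ (of length $\ell$) and $p'$, the correlation vector $\mathcal{C}(p,p')=(\mathcal{C}_0,\dots,\mathcal{C}_{\ell-1})$ has $\mathcal{C}_i=|G_x|/|G_p|$ (the number of words $v$ in the orbit $p$ with $v(i+1,\ell)=x$) if the suffix $x=p(i+1,\ell)$ of length $\ell-i$ is equivalent to the prefix of $p'$ of length $\ell-i$, and $\mathcal{C}_i=0$ otherwise; the correlation polynomial is $\mathcal{C}_{p,p'}(z)=\sum_{i=0}^{\ell-1}\mathcal{C}_iz^i$. A set of distinct patterns is reduced if no substring of a pattern $p'$ of the set is equivalent to another pattern $p$ of the set. -}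

module Defs where

open import Data.Nat as ℕ using (ℕ; zero; suc; _≤_; _≤?_; _∸_)
open import Data.Fin as Fin using (Fin)
open import Data.Fin.Permutation using (Permutation′; _⟨$⟩ʳ_)
open import Data.List using (List; []; _∷_; map; filter; length; tails; take; drop;
  concatMap; foldr; _++_; allFin; upTo)
open import Data.List.Properties using (≡-dec)
open import Data.List.Relation.Unary.Any using (Any; any?)
open import Data.List.Relation.Unary.AllPairs using (AllPairs)
open import Data.List.Membership.Propositional using (_∈_)
open import Data.List.Relation.Binary.Lex.NonStrict using (Lex-≤)
open import Data.Integer as ℤ using (ℤ; +_; -[1+_])
open import Data.Rational as ℚ using (ℚ; 0ℚ; 1ℚ; 1/_)
open import Data.Rational.Properties using () renaming (_≟_ to _≟ℚ_)
open import Data.Product using (Σ; ∃; _×_; _,_)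
open import Data.Bool using (if_then_else_)
open import Relation.Nullary using (¬_; Dec; yes; no; does)
open import Relation.Nullary.Decidable using (_×-dec_)
open import Relation.Binary.PropositionalEquality using (_≡_; _≢_)

Word : ℕ → Set
Word q = List (Fin q)

act : ∀ {q} → Permutation′ q → Word q → Word q
act g = map (g ⟨$⟩ʳ_)

-- A subgroup G of Sym(Fin q), given as the list of its elements
-- (pairwise extensionally distinct, containing the identity, closed
-- under composition; for a finite set this makes it a subgroup).
record Subgroup (q : ℕ) : Set where
  field
    elems    : List (Permutation′ q)
    has-id   : Any (λ g → ∀ a → g ⟨$⟩ʳ a ≡ a) elems
    closed   : ∀ {g h} → g ∈ elems → h ∈ elems →
               Any (λ k → ∀ a → k ⟨$⟩ʳ a ≡ g ⟨$⟩ʳ (h ⟨$⟩ʳ a)) elems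
    distinct : AllPairs (λ g h → ¬ (∀ a → g ⟨$⟩ʳ a ≡ h ⟨$⟩ʳ a)) elems

allWords : ∀ q → ℕ → List (Word q)
allWords q zero    = [] ∷ []
allWords q (suc n) = concatMap (λ a → map (a ∷_) (allWords q n)) (allFin q)

Factor : ∀ {q} → Word q → Word q → Set
Factor u w = ∃ λ a → ∃ λ b → w ≡ a ++ u ++ b

-- a / d as a rational (junk value 0 when d = 0; never used with d = 0)
frac : ℕ → ℕ → ℚ
frac a zero    = 0ℚ
frac a (suc d) = (+ a) ℚ./ suc d

-- multiplicative inverse (junk value 0 at 0)
recip : ℚ → ℚ
recip x with x ≟ℚ 0ℚ
... | yes _ = 0ℚ
... | no ne = 1/_ x {{ℚ.≢-nonZero ne}}

sumℚ : List ℚ → ℚ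
sumℚ = foldr ℚ._+_ 0ℚ

sumℕ : List ℕ → ℕ
sumℕ = foldr ℕ._+_ 0

-- Laurent series with rational coefficients, as coefficient functions ℤ → ℚ

Ser : Set
Ser = ℤ → ℚ

ofSeq : (ℕ → ℕ) → Ser
ofSeq f (+ n)    = (+ f n) ℚ./ 1
ofSeq f -[1+ n ] = 0ℚ

oneS : Ser
oneS (+ zero) = 1ℚ
oneS _        = 0ℚ

_⊕_ : Ser → Ser → Ser
(f ⊕ g) n = f n ℚ.+ g n

_⊖_ : Ser → Ser → Ser
(f ⊖ g) n = f n ℚ.- g n

_⋆_ : ℚ → Ser → Ser
(c ⋆ f) n = c ℚ.* f n

zpow : ℤ → Ser → Ser
zpow k f n = f (n ℤ.- k)

polyMul : List ℚ → Ser → Ser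
polyMul []       f n = 0ℚ
polyMul (c ∷ cs) f n = c ℚ.* f n ℚ.+ polyMul cs f (n ℤ.- ℤ.1ℤ)

sumS : List Ser → Ser
sumS = foldr _⊕_ (λ _ → 0ℚ)

_≈S_ : Ser → Ser → Set
f ≈S g = ∀ n → f n ≡ g n

module WithGroup {q : ℕ} (G : Subgroup q) where
  open Subgroup G

  _∼_ : Word q → Word q → Set
  v ∼ w = Any (λ g → act g v ≡ w) elems

  _∼?_ : (v w : Word q) → Dec (v ∼ w)
  v ∼? w = any? (λ g → ≡-dec Fin._≟_ (act g v) w) elems

  order : ℕ
  order = length elems

  stab : Word q → ℕ
  stab w = length (filter (λ g → ≡-dec Fin._≟_ (act g w) w) elems)

  -- p is the lexicographically least word of its orbit (a pattern representative)
  IsPattern : Word q → Set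
  IsPattern p = ∀ {g} → g ∈ elems → Lex-≤ _≡_ Fin._≤_ p (act g p)

  orbitSize : Word q → ℚ
  orbitSize p = frac order (stab p)

  -- correlation polynomial C_{p,p'} as coefficient list (C₀,…,C_{ℓ-1})
  corrCoeff : Word q → Word q → ℕ → ℚ
  corrCoeff p p' i =
    let ℓ = length p ; x = drop i p in
    if does (x ∼? take (ℓ ∸ i) p') then frac (stab x) (stab p) else 0ℚ

  corr : Word q → Word q → List ℚ
  corr p p' = map (corrCoeff p p') (upTo (length p))

  occ : Word q → Word q → ℕ
  occ p w = length (filter (λ t → (length p ≤? length t) ×-dec (take (length p) t ∼? p))
                           (tails w))

  module WithPatterns {k : ℕ} (ps : Fin k → Word q) where

    Distinct : Set
    Distinct = ∀ i j → i ≢ j → ¬ (ps i ∼ ps j)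

    Reduced : Set
    Reduced = ∀ i j → i ≢ j → ∀ u → Factor u (ps j) → ¬ (u ∼ ps i)

    ℓ : Fin k → ℕ
    ℓ i = length (ps i)

    totalOcc : Word q → ℕ
    totalOcc w = sumℕ (map (λ i → occ (ps i) w) (allFin k))

    avoidCount : ℕ → ℕ
    avoidCount n = length (filter (λ w → totalOcc w ℕ.≟ 0) (allWords q n))

    endCount : Fin k → ℕ → ℕ
    endCount i n = length (filter
      (λ w → (totalOcc w ℕ.≟ 1) ×-dec ((ℓ i ≤? n) ×-dec (drop (n ∸ ℓ i) w ∼? ps i)))
      (allWords q n))

    GenS : Ser
    GenS = ofSeq avoidCount

    GenP : Fin k → Ser
    GenP i = ofSeq (endCount i)

module Submission where

{-
Appending a letter to a word avoiding the
patterns gives either such a word again or a word of exactly one T_i, since by reducedness no two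
patterns can end at the same position; hence A(n+1) + Σ_i T_i(n+1) = q·A(n), the first equation.

For the second, take w ∈ A(n) and g ∈ G. The word w·g(p_j) does not avoid, so exactly one of its
prefixes w·g(p_j(1,m)), 1 ≤ m ≤ ℓ_j, lies in some T_i. Conversely, a word u ∈ T_i of length n + m
arises from |{g : g(p_j(1,m)) = u(n+1,n+m)}| pairs (w, g); when m ≤ ℓ_i this number is
[x ∼ p_j(1,m)]·|G_x| for the suffix x of p_i of length m, and when m > ℓ_i it is 0, as the
occurrence of p_i would lie inside an image of a factor of p_j. So
|G|·A(n) = Σ_i Σ_{s<ℓ_i} [p_i(s+1,ℓ_i) ∼ p_j(1,ℓ_i−s)]·|G_{p_i(s+1,ℓ_i)}|·T_i(n+ℓ_i−s),
and dividing by |G| gives the coefficients of the second equation, as C_s/r_i = |G_x|/|G|.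
-}

open import Level using (Level)
open import Algebra.Bundles using (CommutativeSemiring; CommutativeRing)
open import Data.Nat as ℕ using (ℕ; zero; suc; _∸_; _≤_; _<_; z≤n; s≤s)
import Data.Nat.Properties as ℕP
open import Data.List as List using (List; []; _∷_; _++_; _∷ʳ_; _∷ʳ′_; map; foldr; concatMap; length; filter; take; drop; tails; allFin)
open import Data.List.Membership.Propositional using (_∈_; find; lose)
open import Data.List.Relation.Unary.Any as Any using (Any; here; there)
import Data.List.Relation.Unary.Any.Properties as AnyP
open import Data.Fin as Fin using (Fin; toℕ)
import Data.Fin.Properties as FinP
open import Data.Fin.Permutation using (Permutation′; _⟨$⟩ʳ_; _⟨$⟩ˡ_; inverseˡ; inverseʳ)
import Data.List.Properties as ListP
open import Data.List.Relation.Unary.AllPairs using (AllPairs; []; _∷_)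
open import Data.List.Relation.Unary.All as All using (All; []; _∷_)
import Data.List.Relation.Unary.All.Properties as AllP
open import Data.List.Membership.Propositional.Properties using (∈-allFin)
open import Data.List.Relation.Unary.Unique.Propositional.Properties using (allFin⁺)
open import Data.Empty using (⊥)
open import Data.Product using (_×_; _,_; proj₁; map₂)
open import Data.Sum using (inj₁; inj₂)
open import Function using (_∘_; id; _⇔_; Equivalence; mk⇔)
open import Relation.Nullary using (Dec; yes; no; ¬_; contradiction)
open import Relation.Nullary.Decidable using (_×-dec_)
open import Relation.Binary.PropositionalEquality as ≡ using (_≡_; _≢_)

open import Data.Integer as ℤ using (+_; -[1+_]; -_)
import Data.Integer.Properties as ℤP
open import Data.Integer.Tactic.RingSolver using (solve-∀)
open import Data.Rational as ℚ using (ℚ; 0ℚ; 1ℚ; _/_) renaming (-_ to -ℚ_)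
import Data.Rational.Properties as ℚP
open import Data.Rational.Unnormalised as ℚᵘ using (mkℚᵘ; *≡*)
import Data.Rational.Unnormalised.Properties as ℚᵘP

open import Defs

module FiniteSum {c ℓ} (R : CommutativeSemiring c ℓ) where
  open CommutativeSemiring R
  open import Relation.Binary.Reasoning.Setoid setoid
  open import Algebra.Properties.CommutativeSemigroup +-commutativeSemigroup using (interchange)

  private variable
    a : Level
    A B : Set a

  ∑ : (A → Carrier) → List A → Carrier
  ∑ f xs = foldr _+_ 0# (map f xs)

  ∑< : ℕ → (ℕ → Carrier) → Carrier
  ∑< zero    f = 0#
  ∑< (suc n) f = f 0 + ∑< n (f ∘ suc)

  syntax ∑< n (λ i → e) = ∑[ i < n ] e

  ∑-cong-∈ : ∀ {f g : A → Carrier} xs → (∀ {x} → x ∈ xs → f x ≈ g x) → ∑ f xs ≈ ∑ g xs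
  ∑-cong-∈ []       f≈g = refl
  ∑-cong-∈ (x ∷ xs) f≈g = +-cong (f≈g (here ≡.refl)) (∑-cong-∈ xs (f≈g ∘ there))

  ∑-cong : ∀ {f g : A → Carrier} xs → (∀ x → f x ≈ g x) → ∑ f xs ≈ ∑ g xs
  ∑-cong xs f≈g = ∑-cong-∈ xs (λ {x} _ → f≈g x)

  ∑-zero : ∀ (xs : List A) → ∑ (λ _ → 0#) xs ≈ 0#
  ∑-zero []       = refl
  ∑-zero (x ∷ xs) = trans (+-congˡ (∑-zero xs)) (+-identityʳ 0#)

  ∑-++ : ∀ (f : A → Carrier) xs ys → ∑ f (xs ++ ys) ≈ ∑ f xs + ∑ f ys
  ∑-++ f []       ys = sym (+-identityˡ _)
  ∑-++ f (x ∷ xs) ys = trans (+-congˡ (∑-++ f xs ys)) (sym (+-assoc _ _ _))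

  ∑-map : ∀ (f : B → Carrier) (g : A → B) xs → ∑ f (map g xs) ≈ ∑ (f ∘ g) xs
  ∑-map f g []       = refl
  ∑-map f g (x ∷ xs) = +-congˡ (∑-map f g xs)

  ∑-concatMap : ∀ (f : B → Carrier) (g : A → List B) xs →
                ∑ f (concatMap g xs) ≈ ∑ (λ x → ∑ f (g x)) xs
  ∑-concatMap f g []       = refl
  ∑-concatMap f g (x ∷ xs) = trans (∑-++ f (g x) (concatMap g xs)) (+-congˡ (∑-concatMap f g xs))

  ∑-+ : ∀ (f g : A → Carrier) xs → ∑ (λ x → f x + g x) xs ≈ ∑ f xs + ∑ g xs
  ∑-+ f g []       = sym (+-identityˡ 0#)
  ∑-+ f g (x ∷ xs) = trans (+-congˡ (∑-+ f g xs)) (interchange (f x) (g x) (∑ f xs) (∑ g xs))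

  ∑-*ˡ : ∀ c (f : A → Carrier) xs → ∑ (λ x → c * f x) xs ≈ c * ∑ f xs
  ∑-*ˡ c f []       = sym (zeroʳ c)
  ∑-*ˡ c f (x ∷ xs) = trans (+-congˡ (∑-*ˡ c f xs)) (sym (distribˡ c (f x) _))

  ∑-*ʳ : ∀ (f : A → Carrier) c xs → ∑ (λ x → f x * c) xs ≈ ∑ f xs * c
  ∑-*ʳ f c []       = sym (zeroˡ c)
  ∑-*ʳ f c (x ∷ xs) = trans (+-congˡ (∑-*ʳ f c xs)) (sym (distribʳ c (f x) _))

  ∑-swap : ∀ (f : A → B → Carrier) xs ys →
           ∑ (λ x → ∑ (f x) ys) xs ≈ ∑ (λ y → ∑ (λ x → f x y) xs) ys
  ∑-swap f []       ys = sym (∑-zero ys)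
  ∑-swap f (x ∷ xs) ys = trans (+-congˡ (∑-swap f xs ys)) (sym (∑-+ (f x) _ ys))

  ∑<-cong : ∀ {f g : ℕ → Carrier} n → (∀ i → i < n → f i ≈ g i) → ∑< n f ≈ ∑< n g
  ∑<-cong zero    f≈g = refl
  ∑<-cong (suc n) f≈g = +-cong (f≈g 0 (s≤s z≤n)) (∑<-cong n (λ i i<n → f≈g (suc i) (s≤s i<n)))

  ∑<-zero : ∀ n → ∑[ i < n ] 0# ≈ 0#
  ∑<-zero zero    = refl
  ∑<-zero (suc n) = trans (+-congˡ (∑<-zero n)) (+-identityʳ 0#)

  ∑<-*ˡ : ∀ c f n → ∑[ i < n ] (c * f i) ≈ c * ∑< n f
  ∑<-*ˡ c f zero    = sym (zeroʳ c)
  ∑<-*ˡ c f (suc n) = trans (+-congˡ (∑<-*ˡ c (f ∘ suc) n)) (sym (distribˡ c (f 0) _))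

  ∑<-snoc : ∀ f n → ∑< (suc n) f ≈ ∑< n f + f n
  ∑<-snoc f zero    = +-comm (f 0) 0#
  ∑<-snoc f (suc n) = trans (+-congˡ (∑<-snoc (f ∘ suc) n)) (sym (+-assoc _ _ _))

  ∑<-reverse : ∀ f n → ∑< n f ≈ ∑[ i < n ] f (n ∸ suc i)
  ∑<-reverse f zero    = refl
  ∑<-reverse f (suc n) = begin
    ∑< (suc n) f                     ≈⟨ ∑<-snoc f n ⟩
    ∑< n f + f n                     ≈⟨ +-comm _ (f n) ⟩
    f n + ∑< n f                     ≈⟨ +-congˡ (∑<-reverse f n) ⟩
    f n + ∑[ i < n ] f (n ∸ suc i)   ∎

  ∑<-vanishing : ∀ f {m n} → m ≤ n → (∀ i → m ≤ i → f i ≈ 0#) → ∑< n f ≈ ∑< m f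
  ∑<-vanishing f {zero} {n} _ f≈0 = trans (∑<-cong n (λ i _ → f≈0 i z≤n)) (∑<-zero n)
  ∑<-vanishing f {suc m} {suc n} (s≤s m≤n) f≈0 =
    +-congˡ (∑<-vanishing (f ∘ suc) m≤n (λ i m≤i → f≈0 (suc i) (s≤s m≤i)))

  ∑<-length-irrelevant : ∀ f m n → (∀ i → m ≤ i → f i ≈ 0#) → (∀ i → n ≤ i → f i ≈ 0#) →
                         ∑< m f ≈ ∑< n f
  ∑<-length-irrelevant f m n f≈0ₘ f≈0ₙ with ℕP.≤-total m n
  ... | inj₁ m≤n = sym (∑<-vanishing f m≤n f≈0ₘ)
  ... | inj₂ n≤m = ∑<-vanishing f n≤m f≈0ₙ

  ∑-∑<-swap : ∀ (f : A → ℕ → Carrier) xs n →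
              ∑ (λ x → ∑< n (f x)) xs ≈ ∑[ i < n ] ∑ (λ x → f x i) xs
  ∑-∑<-swap f xs zero    = ∑-zero xs
  ∑-∑<-swap f xs (suc n) =
    trans (∑-+ (λ x → f x 0) (λ x → ∑< n (f x ∘ suc)) xs) (+-congˡ (∑-∑<-swap (λ x → f x ∘ suc) xs n))

open import Data.Nat using (_+_; _*_)

open FiniteSum ℕP.+-*-commutativeSemiring
open import Algebra.Properties.CommutativeSemigroup ℕP.+-commutativeSemigroup
  using () renaming (x∙yz≈y∙xz to ℕ-x∙yz≈y∙xz; x∙yz≈yx∙z to ℕ-x∙yz≈yx∙z)
module ℚ∑ = FiniteSum (CommutativeRing.commutativeSemiring ℚP.+-*-commutativeRing)

𝟙 : ∀ {p} {P : Set p} → Dec P → ℕ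
𝟙 (yes _) = 1
𝟙 (no _)  = 0

module _ {p} {P : Set p} where

  𝟙-yes : P → (P? : Dec P) → 𝟙 P? ≡ 1
  𝟙-yes p (yes _) = ≡.refl
  𝟙-yes p (no ¬p) = contradiction p ¬p

  𝟙-no : ¬ P → (P? : Dec P) → 𝟙 P? ≡ 0
  𝟙-no ¬p (yes p) = contradiction p ¬p
  𝟙-no ¬p (no _)  = ≡.refl

  𝟙-*-cong : ∀ {x y} → (P → x ≡ y) → (P? : Dec P) → 𝟙 P? * x ≡ 𝟙 P? * y
  𝟙-*-cong x≡y (yes p) = ≡.cong (1 *_) (x≡y p)
  𝟙-*-cong x≡y (no _)  = ≡.refl

module _ {p r} {P : Set p} {Q : Set r} where

  𝟙-cong : P ⇔ Q → (P? : Dec P) (Q? : Dec Q) → 𝟙 P? ≡ 𝟙 Q?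
  𝟙-cong P⇔Q (yes p) Q? = ≡.sym (𝟙-yes (Equivalence.to P⇔Q p) Q?)
  𝟙-cong P⇔Q (no ¬p) Q? = ≡.sym (𝟙-no (¬p ∘ Equivalence.from P⇔Q) Q?)

  𝟙-× : (P? : Dec P) (Q? : Dec Q) → 𝟙 (P? ×-dec Q?) ≡ 𝟙 P? * 𝟙 Q?
  𝟙-× (yes _) (yes _) = ≡.refl
  𝟙-× (yes _) (no _)  = ≡.refl
  𝟙-× (no _)  _       = ≡.refl

module _ {a p} {A : Set a} {P : A → Set p} (P? : ∀ x → Dec (P x)) where

  length-filter≡∑𝟙 : ∀ xs → length (filter P? xs) ≡ ∑ (𝟙 ∘ P?) xs
  length-filter≡∑𝟙 []       = ≡.refl
  length-filter≡∑𝟙 (x ∷ xs) with P? x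
  ... | yes _ = ≡.cong suc (length-filter≡∑𝟙 xs)
  ... | no _  = length-filter≡∑𝟙 xs

  ∑𝟙-exclusive : ∀ {xs} → AllPairs _≢_ xs → (∀ {x y} → x ≢ y → P x → ¬ P y) → ∑ (𝟙 ∘ P?) xs ≤ 1
  ∑𝟙-exclusive {[]}     []           _    = z≤n
  ∑𝟙-exclusive {x ∷ xs} (x≢xs ∷ xs!) excl with P? x
  ... | no _   = ∑𝟙-exclusive xs! excl
  ... | yes px = ℕP.≤-reflexive (≡.cong suc (≡.trans
                   (∑-cong-∈ xs (λ y∈xs → 𝟙-no (excl (All.lookup x≢xs y∈xs) px) (P? _))) (∑-zero xs)))

∑-𝟙≡ : ∀ {a} {A : Set a} (_≟_ : (x y : A) → Dec (x ≡ y)) {b xs} → AllPairs _≢_ xs → b ∈ xs →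
        ∀ (f : A → ℕ) → ∑ (λ x → 𝟙 (b ≟ x) * f x) xs ≡ f b
∑-𝟙≡ _≟_ {b} {b ∷ xs} (b≢xs ∷ _) (here ≡.refl) f = begin
  𝟙 (b ≟ b) * f b + ∑ (λ x → 𝟙 (b ≟ x) * f x) xs
    ≡⟨ ≡.cong₂ _+_ (≡.cong (_* f b) (𝟙-yes ≡.refl (b ≟ b)))
         (≡.trans (∑-cong-∈ xs (λ x∈ → ≡.cong (_* f _) (𝟙-no (All.lookup b≢xs x∈) (b ≟ _)))) (∑-zero xs)) ⟩
  1 * f b + 0
    ≡⟨ ℕP.+-identityʳ _ ⟩
  1 * f b
    ≡⟨ ℕP.*-identityˡ (f b) ⟩
  f b ∎
  where open ≡.≡-Reasoning
∑-𝟙≡ _≟_ {b} {x ∷ xs} (x≢xs ∷ xs!) (there b∈) f =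
  ≡.cong₂ _+_ (≡.cong (_* f x) (𝟙-no (λ b≡x → All.lookup x≢xs b∈ (≡.sym b≡x)) (b ≟ x)))
              (∑-𝟙≡ _≟_ xs! b∈ f)

𝟙≡0-+ : ∀ t e → e ≤ 1 → 𝟙 (t + e ℕ.≟ 0) + 𝟙 (t + e ℕ.≟ 1) * e ≡ 𝟙 (t ℕ.≟ 0)
𝟙≡0-+ t zero _ = ≡.trans
  (≡.cong₂ _+_ (≡.cong (λ x → 𝟙 (x ℕ.≟ 0)) (ℕP.+-identityʳ t)) (ℕP.*-zeroʳ (𝟙 (t + 0 ℕ.≟ 1))))
  (ℕP.+-identityʳ _)
𝟙≡0-+ t (suc zero) _ = ≡.trans
  (≡.cong₂ _+_ (𝟙-no (λ t+1≡0 → ℕP.1+n≢0 (≡.trans (ℕP.+-comm 1 t) t+1≡0)) (t + 1 ℕ.≟ 0)) (ℕP.*-identityʳ _))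
  (𝟙-cong (mk⇔ (ℕP.+-cancelʳ-≡ 1 t 0) (≡.cong (_+ 1))) (t + 1 ℕ.≟ 1) (t ℕ.≟ 0))
𝟙≡0-+ t (suc (suc _)) (s≤s ())

∑-const : ∀ {a} {A : Set a} c (xs : List A) → ∑ (λ _ → c) xs ≡ length xs * c
∑-const c []       = ≡.refl
∑-const c (x ∷ xs) = ≡.cong (_+_ c) (∑-const c xs)

term≤∑ : ∀ {a} {A : Set a} (f : A → ℕ) {x xs} → x ∈ xs → f x ≤ ∑ f xs
term≤∑ f (here ≡.refl)          = ℕP.m≤m+n _ _
term≤∑ f {xs = y ∷ _} (there x∈) = ℕP.≤-trans (term≤∑ f x∈) (ℕP.m≤n+m _ (f y))

-- Definitionally the coefficient form used by ofSeq.
ι : ℕ → ℚ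
ι a = + a ℚ./ 1

fromℚᵘ-homo-+ : ∀ x y → ℚ.fromℚᵘ (x ℚᵘ.+ y) ≡ ℚ.fromℚᵘ x ℚ.+ ℚ.fromℚᵘ y
fromℚᵘ-homo-+ x y = ℚP.toℚᵘ-injective (begin
  ℚ.toℚᵘ (ℚ.fromℚᵘ (x ℚᵘ.+ y))                  ≈⟨ ℚP.toℚᵘ-fromℚᵘ (x ℚᵘ.+ y) ⟩
  x ℚᵘ.+ y                                      ≈⟨ ℚᵘP.+-cong (ℚP.toℚᵘ-fromℚᵘ x) (ℚP.toℚᵘ-fromℚᵘ y) ⟨
  ℚ.toℚᵘ (ℚ.fromℚᵘ x) ℚᵘ.+ ℚ.toℚᵘ (ℚ.fromℚᵘ y)  ≈⟨ ℚP.toℚᵘ-homo-+ (ℚ.fromℚᵘ x) (ℚ.fromℚᵘ y) ⟨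
  ℚ.toℚᵘ (ℚ.fromℚᵘ x ℚ.+ ℚ.fromℚᵘ y)            ∎)
  where open ℚᵘP.≃-Reasoning

fromℚᵘ-homo-* : ∀ x y → ℚ.fromℚᵘ (x ℚᵘ.* y) ≡ ℚ.fromℚᵘ x ℚ.* ℚ.fromℚᵘ y
fromℚᵘ-homo-* x y = ℚP.toℚᵘ-injective (begin
  ℚ.toℚᵘ (ℚ.fromℚᵘ (x ℚᵘ.* y))                  ≈⟨ ℚP.toℚᵘ-fromℚᵘ (x ℚᵘ.* y) ⟩
  x ℚᵘ.* y                                      ≈⟨ ℚᵘP.*-cong (ℚP.toℚᵘ-fromℚᵘ x) (ℚP.toℚᵘ-fromℚᵘ y) ⟨
  ℚ.toℚᵘ (ℚ.fromℚᵘ x) ℚᵘ.* ℚ.toℚᵘ (ℚ.fromℚᵘ y)  ≈⟨ ℚP.toℚᵘ-homo-* (ℚ.fromℚᵘ x) (ℚ.fromℚᵘ y) ⟨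
  ℚ.toℚᵘ (ℚ.fromℚᵘ x ℚ.* ℚ.fromℚᵘ y)            ∎)
  where open ℚᵘP.≃-Reasoning

ι-+ : ∀ a b → ι (a + b) ≡ ι a ℚ.+ ι b
ι-+ a b = ≡.trans
  (ℚP.fromℚᵘ-cong {mkℚᵘ (+ (a + b)) 0} {mkℚᵘ (+ a) 0 ℚᵘ.+ mkℚᵘ (+ b) 0}
    (*≡* (≡.trans (≡.cong (ℤ._* + 1) (ℤP.pos-+ a b)) (lemma (+ a) (+ b)))))
  (fromℚᵘ-homo-+ (mkℚᵘ (+ a) 0) (mkℚᵘ (+ b) 0))
  where
  lemma : ∀ x y → (x ℤ.+ y) ℤ.* + 1 ≡ (x ℤ.* + 1 ℤ.+ y ℤ.* + 1) ℤ.* + 1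
  lemma = solve-∀

ι-* : ∀ a b → ι (a * b) ≡ ι a ℚ.* ι b
ι-* a b = ≡.trans
  (ℚP.fromℚᵘ-cong {mkℚᵘ (+ (a * b)) 0} {mkℚᵘ (+ a) 0 ℚᵘ.* mkℚᵘ (+ b) 0}
    (*≡* (≡.cong (ℤ._* + 1) (ℤP.pos-* a b))))
  (fromℚᵘ-homo-* (mkℚᵘ (+ a) 0) (mkℚᵘ (+ b) 0))

/-*-ι : ∀ a d → (+ a ℚ./ suc d) ℚ.* ι (suc d) ≡ ι a
/-*-ι a d = ≡.trans
  (≡.sym (fromℚᵘ-homo-* (mkℚᵘ (+ a) d) (mkℚᵘ (+ suc d) 0)))
  (ℚP.fromℚᵘ-cong {mkℚᵘ (+ a) d ℚᵘ.* mkℚᵘ (+ suc d) 0} {mkℚᵘ (+ a) 0} (*≡* (lemma (+ a) (+ suc d))))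
  where
  lemma : ∀ x y → (x ℤ.* y) ℤ.* + 1 ≡ x ℤ.* (y ℤ.* + 1)
  lemma = solve-∀

ι-suc≢0 : ∀ a → ι (suc a) ≢ 0ℚ
ι-suc≢0 a eq with ℚᵘP.≃-trans (ℚᵘP.≃-sym (ℚP.toℚᵘ-fromℚᵘ (mkℚᵘ (+ suc a) 0))) (ℚP.toℚᵘ-cong eq)
... | *≡* ()

ι-∑ : ∀ {a} {A : Set a} (f : A → ℕ) xs → ι (∑ f xs) ≡ ℚ∑.∑ (ι ∘ f) xs
ι-∑ f []       = ≡.refl
ι-∑ f (x ∷ xs) = ≡.trans (ι-+ (f x) _) (≡.cong (ι (f x) ℚ.+_) (ι-∑ f xs))

ι-∑< : ∀ f n → ι (∑< n f) ≡ ℚ∑.∑< n (ι ∘ f)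
ι-∑< f zero    = ≡.refl
ι-∑< f (suc n) = ≡.trans (ι-+ (f 0) _) (≡.cong (ι (f 0) ℚ.+_) (ι-∑< (f ∘ suc) n))

recip-inverseˡ : ∀ x → x ≢ 0ℚ → recip x ℚ.* x ≡ 1ℚ
recip-inverseˡ x x≢0 with x ℚP.≟ 0ℚ
... | yes x≡0 = contradiction x≡0 x≢0
... | no x≢0′ = ℚP.*-inverseˡ x {{ℚ.≢-nonZero x≢0′}}

frac-cancel : ∀ N a d → 1 ≤ N → 1 ≤ d → ι N ℚ.* (recip (frac N d) ℚ.* frac a d) ≡ ι a
frac-cancel (suc N) a (suc d) _ _ = begin
  ι (suc N) ℚ.* (recip u ℚ.* v)                 ≡⟨ ≡.cong (ℚ._* (recip u ℚ.* v)) (/-*-ι (suc N) d) ⟨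
  (u ℚ.* ι (suc d)) ℚ.* (recip u ℚ.* v)         ≡⟨ rearrange u (ι (suc d)) (recip u) v ⟩
  (recip u ℚ.* u) ℚ.* (v ℚ.* ι (suc d))         ≡⟨ ≡.cong₂ ℚ._*_ (recip-inverseˡ u u≢0) (/-*-ι a d) ⟩
  1ℚ ℚ.* ι a                                    ≡⟨ ℚP.*-identityˡ (ι a) ⟩
  ι a                                           ∎
  where
  open ≡.≡-Reasoning
  open import Data.Rational.Solver using (module +-*-Solver)
  open +-*-Solver
  u = + suc N ℚ./ suc d
  v = + a ℚ./ suc d
  rearrange : ∀ u s r v → (u ℚ.* s) ℚ.* (r ℚ.* v) ≡ (r ℚ.* u) ℚ.* (v ℚ.* s)
  rearrange = solve 4 (λ u s r v → (u :* s) :* (r :* v) := (r :* u) :* (v :* s)) ≡.refl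
  u≢0 : u ≢ 0ℚ
  u≢0 u≡0 = ι-suc≢0 N (≡.trans (≡.sym (/-*-ι (suc N) d))
                                (≡.trans (≡.cong (ℚ._* ι (suc d)) u≡0) (ℚP.*-zeroˡ (ι (suc d)))))

ι-cancelˡ : ∀ N → 1 ≤ N → ∀ {x y} → ι N ℚ.* x ≡ ι N ℚ.* y → x ≡ y
ι-cancelˡ (suc N) _ {x} {y} eq = begin
  x                                          ≡⟨ cancel x ⟨
  recip (ι (suc N)) ℚ.* (ι (suc N) ℚ.* x)    ≡⟨ ≡.cong (recip (ι (suc N)) ℚ.*_) eq ⟩
  recip (ι (suc N)) ℚ.* (ι (suc N) ℚ.* y)    ≡⟨ cancel y ⟩
  y                                          ∎
  where
  open ≡.≡-Reasoning
  cancel : ∀ z → recip (ι (suc N)) ℚ.* (ι (suc N) ℚ.* z) ≡ z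
  cancel z = ≡.trans (≡.sym (ℚP.*-assoc (recip (ι (suc N))) (ι (suc N)) z))
    (≡.trans (≡.cong (ℚ._* z) (recip-inverseˡ (ι (suc N)) (ι-suc≢0 N))) (ℚP.*-identityˡ z))

module _ {a} {A : Set a} where

  length-∷ʳ : ∀ (w : List A) x → length (w ∷ʳ x) ≡ suc (length w)
  length-∷ʳ w x = ≡.trans (ListP.length-++ w) (ℕP.+-comm (length w) 1)

  take-++ˡ : ∀ n (u v : List A) → n ≤ length u → take n (u ++ v) ≡ take n u
  take-++ˡ zero    u       v _         = ≡.refl
  take-++ˡ (suc n) (x ∷ u) v (s≤s n≤u) = ≡.cong (x ∷_) (take-++ˡ n u v n≤u)

  drop-++ˡ : ∀ (u v : List A) → drop (length u) (u ++ v) ≡ v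
  drop-++ˡ []      v = ≡.refl
  drop-++ˡ (x ∷ u) v = drop-++ˡ u v

∸-telescope : ∀ {a b c} → c ≤ b → b ≤ a → (a ∸ b) + (b ∸ c) ≡ a ∸ c
∸-telescope {a} {b} {c} c≤b b≤a =
  ≡.trans (≡.sym (ℕP.+-∸-assoc (a ∸ b) c≤b)) (≡.cong (_∸ c) (ℕP.m∸n+n≡m b≤a))

module _ {q : ℕ} where

  _≟ʷ_ : (v w : Word q) → Dec (v ≡ w)
  _≟ʷ_ = ListP.≡-dec Fin._≟_

  factor-refl : ∀ (w : Word q) → Factor w w
  factor-refl w = [] , [] , ≡.sym (ListP.++-identityʳ w)

  factor-trans : ∀ {u v w : Word q} → Factor u v → Factor v w → Factor u w
  factor-trans {u} (a , b , ≡.refl) (c , d , ≡.refl) = c ++ a , b ++ d , (begin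
    c ++ (a ++ u ++ b) ++ d   ≡⟨ ≡.cong (c ++_) (ListP.++-assoc a (u ++ b) d) ⟩
    c ++ a ++ (u ++ b) ++ d   ≡⟨ ≡.cong (λ t → c ++ a ++ t) (ListP.++-assoc u b d) ⟩
    c ++ a ++ u ++ b ++ d     ≡⟨ ListP.++-assoc c a (u ++ b ++ d) ⟨
    (c ++ a) ++ u ++ b ++ d   ∎)
    where open ≡.≡-Reasoning

  factor-map : ∀ (f : Fin q → Fin q) {u v : Word q} → Factor u v → Factor (map f u) (map f v)
  factor-map f {u} (a , b , ≡.refl) =
    map f a , map f b , ≡.trans (ListP.map-++ f a (u ++ b)) (≡.cong (map f a ++_) (ListP.map-++ f u b))

  drop-factor : ∀ n (w : Word q) → Factor (drop n w) w
  drop-factor n w = take n w , [] ,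
    ≡.trans (≡.sym (ListP.take++drop≡id n w)) (≡.cong (take n w ++_) (≡.sym (ListP.++-identityʳ (drop n w))))

  take-factor : ∀ n (w : Word q) → Factor (take n w) w
  take-factor n w = [] , drop n w , ≡.sym (ListP.take++drop≡id n w)

  suffix-factor : ∀ {m n} (w : Word q) → m ≤ n → n ≤ length w →
                  Factor (drop (length w ∸ m) w) (drop (length w ∸ n) w)
  suffix-factor {m} {n} w m≤n n≤w = ≡.subst (λ v → Factor v (drop (length w ∸ n) w))
    (≡.trans (ListP.drop-drop (length w ∸ n) (n ∸ m) w) (≡.cong (λ t → drop t w) (∸-telescope m≤n n≤w)))
    (drop-factor (n ∸ m) (drop (length w ∸ n) w))

  allWords-length : ∀ n → All (λ w → length w ≡ n) (allWords q n)
  allWords-length zero    = ≡.refl ∷ []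
  allWords-length (suc n) = AllP.concat⁺ (AllP.map⁺ (AllP.tabulate⁺ {f = id}
    (λ a → AllP.map⁺ {f = a ∷_} (All.map (≡.cong suc) (allWords-length n)))))

  ∑-allWords-++ : ∀ m n (f : Word q → ℕ) →
                  ∑ f (allWords q (m + n)) ≡ ∑ (λ u → ∑ (λ v → f (u ++ v)) (allWords q n)) (allWords q m)
  ∑-allWords-++ zero    n f = ≡.sym (ℕP.+-identityʳ _)
  ∑-allWords-++ (suc m) n f = begin
    ∑ f (concatMap (λ a → map (a ∷_) (allWords q (m + n))) (allFin q))
      ≡⟨ ∑-concatMap f (λ a → map (a ∷_) (allWords q (m + n))) (allFin q) ⟩
    ∑ (λ a → ∑ f (map (a ∷_) (allWords q (m + n)))) (allFin q)
      ≡⟨ ∑-cong (allFin q) (λ a →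
           ≡.trans (∑-map f (a ∷_) (allWords q (m + n))) (∑-allWords-++ m n (f ∘ (a ∷_)))) ⟩
    ∑ (λ a → ∑ (λ u → ∑ (λ v → f (a ∷ u ++ v)) (allWords q n)) (allWords q m)) (allFin q)
      ≡⟨ ∑-cong (allFin q) (λ a → ∑-map inner (a ∷_) (allWords q m)) ⟨
    ∑ (λ a → ∑ (λ u → ∑ (λ v → f (u ++ v)) (allWords q n)) (map (a ∷_) (allWords q m))) (allFin q)
      ≡⟨ ∑-concatMap inner (λ a → map (a ∷_) (allWords q m)) (allFin q) ⟨
    ∑ (λ u → ∑ (λ v → f (u ++ v)) (allWords q n)) (allWords q (suc m)) ∎
    where
    open ≡.≡-Reasoning
    inner : Word q → ℕ
    inner u = ∑ (λ v → f (u ++ v)) (allWords q n)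

  ∑-allWords-∷ʳ : ∀ n (f : Word q → ℕ) →
                  ∑ f (allWords q (suc n)) ≡ ∑ (λ u → ∑ (λ a → f (u ∷ʳ a)) (allFin q)) (allWords q n)
  ∑-allWords-∷ʳ n f = begin
    ∑ f (allWords q (suc n))                                      ≡⟨ ≡.cong (∑ f ∘ allWords q) (ℕP.+-comm 1 n) ⟩
    ∑ f (allWords q (n + 1))                                      ≡⟨ ∑-allWords-++ n 1 f ⟩
    ∑ (λ u → ∑ (λ v → f (u ++ v)) (allWords q 1)) (allWords q n)  ≡⟨ ∑-cong (allWords q n) one-letter ⟩
    ∑ (λ u → ∑ (λ a → f (u ∷ʳ a)) (allFin q)) (allWords q n)      ∎
    where
    open ≡.≡-Reasoning
    one-letter : ∀ u → ∑ (λ v → f (u ++ v)) (allWords q 1) ≡ ∑ (λ a → f (u ∷ʳ a)) (allFin q)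
    one-letter u = ≡.trans (∑-concatMap (λ v → f (u ++ v)) (λ a → map (a ∷_) (allWords q 0)) (allFin q))
                           (∑-cong (allFin q) (λ a → ℕP.+-identityʳ _))

  𝟙-≟ʷ-∷ : ∀ (b : Fin q) c a v → 𝟙 ((b ∷ c) ≟ʷ (a ∷ v)) ≡ 𝟙 (b Fin.≟ a) * 𝟙 (c ≟ʷ v)
  𝟙-≟ʷ-∷ b c a v = ≡.trans (𝟙-cong (mk⇔ ListP.∷-injective (λ { (≡.refl , ≡.refl) → ≡.refl })) _
                                   ((b Fin.≟ a) ×-dec (c ≟ʷ v)))
                           (𝟙-× (b Fin.≟ a) (c ≟ʷ v))

  ∑-allWords-𝟙≡ : ∀ n c → length c ≡ n → ∀ (f : Word q → ℕ) →
                  ∑ (λ v → 𝟙 (c ≟ʷ v) * f v) (allWords q n) ≡ f c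
  ∑-allWords-𝟙≡ zero    []      _  f = ≡.trans (ℕP.+-identityʳ _) (ℕP.+-identityʳ (f []))
  ∑-allWords-𝟙≡ (suc n) (b ∷ c) lc f = begin
    ∑ (λ v → 𝟙 ((b ∷ c) ≟ʷ v) * f v) (concatMap (λ a → map (a ∷_) (allWords q n)) (allFin q))
      ≡⟨ ∑-concatMap (λ v → 𝟙 ((b ∷ c) ≟ʷ v) * f v) (λ a → map (a ∷_) (allWords q n)) (allFin q) ⟩
    ∑ (λ a → ∑ (λ v → 𝟙 ((b ∷ c) ≟ʷ v) * f v) (map (a ∷_) (allWords q n))) (allFin q)
      ≡⟨ ∑-cong (allFin q) (λ a → ≡.trans (∑-map (λ v → 𝟙 ((b ∷ c) ≟ʷ v) * f v) (a ∷_) (allWords q n))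
           (∑-cong (allWords q n) (λ v →
             ≡.trans (≡.cong (_* f (a ∷ v)) (𝟙-≟ʷ-∷ b c a v)) (ℕP.*-assoc (𝟙 (b Fin.≟ a)) _ _)))) ⟩
    ∑ (λ a → ∑ (λ v → 𝟙 (b Fin.≟ a) * (𝟙 (c ≟ʷ v) * f (a ∷ v))) (allWords q n)) (allFin q)
      ≡⟨ ∑-cong (allFin q) (λ a → ≡.trans (∑-*ˡ (𝟙 (b Fin.≟ a)) _ (allWords q n))
           (≡.cong (𝟙 (b Fin.≟ a) *_) (∑-allWords-𝟙≡ n c (ℕP.suc-injective lc) (f ∘ (a ∷_))))) ⟩
    ∑ (λ a → 𝟙 (b Fin.≟ a) * f (a ∷ c)) (allFin q)
      ≡⟨ ∑-𝟙≡ Fin._≟_ (allFin⁺ q) (∈-allFin b) (λ a → f (a ∷ c)) ⟩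
    f (b ∷ c) ∎
    where open ≡.≡-Reasoning

module GroupAction {q : ℕ} (G : Subgroup q) where
  open Subgroup G
  open WithGroup G

  Perm : Set
  Perm = Permutation′ q

  _actsAs_ : Perm → (Fin q → Fin q) → Set
  g actsAs f = ∀ a → g ⟨$⟩ʳ a ≡ f a

  _actsAs?_ : ∀ g f → Dec (g actsAs f)
  g actsAs? f = FinP.all? (λ a → g ⟨$⟩ʳ a Fin.≟ f a)

  InG : (Fin q → Fin q) → Set
  InG f = Any (_actsAs f) elems

  InG-∈ : ∀ {g} → g ∈ elems → InG (g ⟨$⟩ʳ_)
  InG-∈ g∈ = lose g∈ (λ _ → ≡.refl)

  InG-cong : ∀ {f f′} → (∀ a → f a ≡ f′ a) → InG f → InG f′
  InG-cong f≗f′ = Any.map (λ g≗f a → ≡.trans (g≗f a) (f≗f′ a))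

  InG-∘ : ∀ {f f′} → InG f → InG f′ → InG (f ∘ f′)
  InG-∘ {f} {f′} F F′ with find F | find F′
  ... | g , g∈ , g≗f | h , h∈ , h≗f′ =
    Any.map (λ k≗gh a → ≡.trans (k≗gh a) (≡.trans (g≗f _) (≡.cong f (h≗f′ a)))) (closed g∈ h∈)

  power : Perm → ℕ → Fin q → Fin q
  power g zero    = id
  power g (suc t) = (g ⟨$⟩ʳ_) ∘ power g t

  InG-power : ∀ {g} → g ∈ elems → ∀ t → InG (power g t)
  InG-power g∈ zero    = has-id
  InG-power g∈ (suc t) = InG-∘ (InG-∈ g∈) (InG-power g∈ t)

  power-+ : ∀ g m n a → power g (m + n) a ≡ power g m (power g n a)
  power-+ g zero    n a = ≡.refl
  power-+ g (suc m) n a = ≡.cong (g ⟨$⟩ʳ_) (power-+ g m n a)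

  ⟨$⟩ʳ-injective : ∀ (g : Perm) {a b} → g ⟨$⟩ʳ a ≡ g ⟨$⟩ʳ b → a ≡ b
  ⟨$⟩ʳ-injective g {a} {b} eq = ≡.trans (≡.sym (inverseˡ g)) (≡.trans (≡.cong (g ⟨$⟩ˡ_) eq) (inverseˡ g))

  act-injective : ∀ g {v w} → act g v ≡ act g w → v ≡ w
  act-injective g = ListP.map-injective (⟨$⟩ʳ-injective g)

  power-injective : ∀ g m {a b} → power g m a ≡ power g m b → a ≡ b
  power-injective g zero    eq = eq
  power-injective g (suc m) eq = power-injective g m (⟨$⟩ʳ-injective g eq)

  power-period⇒inverse : ∀ g i d → (∀ a → power g i a ≡ power g (suc i + d) a) →
                         ∀ b → power g d b ≡ g ⟨$⟩ˡ b
  power-period⇒inverse g i d period b = begin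
    power g d b                     ≡⟨ inverseˡ g ⟨
    g ⟨$⟩ˡ power g (suc d) b        ≡⟨ ≡.cong (g ⟨$⟩ˡ_) (power-injective g i (begin
      power g i (power g (suc d) b)   ≡⟨ power-+ g i (suc d) b ⟨
      power g (i + suc d) b           ≡⟨ ≡.cong (λ t → power g t b) (ℕP.+-suc i d) ⟩
      power g (suc i + d) b           ≡⟨ period b ⟨
      power g i b                     ∎)) ⟩
    g ⟨$⟩ˡ b                        ∎
    where open ≡.≡-Reasoning

  -- Pigeonhole: two of the |G| + 1 powers g⁰, …, g^|G| are realised by the same element of G.
  InG-inverse : ∀ {g} → g ∈ elems → InG (g ⟨$⟩ˡ_)
  InG-inverse {g} g∈ with FinP.pigeonhole (ℕP.n<1+n (length elems)) (λ t → Any.index (InG-power g∈ (toℕ t)))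
  ... | i , j , i<j , same-index with ℕP.m≤n⇒∃[o]m+o≡n i<j
  ... | d , i+d≡j = InG-cong (power-period⇒inverse g (toℕ i) d period) (InG-power g∈ d)
    where
    period : ∀ a → power g (toℕ i) a ≡ power g (suc (toℕ i) + d) a
    period a = ≡.trans (≡.sym (AnyP.lookup-index (InG-power g∈ (toℕ i)) a)) (≡.trans
      (≡.cong (λ t → List.lookup elems t ⟨$⟩ʳ a) same-index)
      (≡.trans (AnyP.lookup-index (InG-power g∈ (toℕ j)) a) (≡.cong (λ t → power g t a) (≡.sym i+d≡j))))

  same-action : ∀ {g h f} → g actsAs f → h actsAs f → ∀ a → g ⟨$⟩ʳ a ≡ h ⟨$⟩ʳ a
  same-action g≗f h≗f a = ≡.trans (g≗f a) (≡.sym (h≗f a))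

  count-actsAs : ∀ {f} → InG f → ∑ (λ k → 𝟙 (k actsAs? f)) elems ≡ 1
  count-actsAs = count distinct
    where
    count : ∀ {f xs} → AllPairs (λ g h → ¬ (∀ a → g ⟨$⟩ʳ a ≡ h ⟨$⟩ʳ a)) xs → Any (_actsAs f) xs →
            ∑ (λ k → 𝟙 (k actsAs? f)) xs ≡ 1
    count {f} {x ∷ xs} (x≢xs ∷ _) (here x≗f) = ≡.cong₂ _+_ (𝟙-yes x≗f (x actsAs? f))
      (≡.trans (∑-cong-∈ xs (λ {y} y∈ → 𝟙-no (λ y≗f → All.lookup x≢xs y∈ (same-action {x} {y} x≗f y≗f))
                                                (y actsAs? f)))
               (∑-zero xs))
    count {f} {x ∷ xs} (x≢xs ∷ xs!) (there f∈xs) with find f∈xs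
    ... | y , y∈ , y≗f = ≡.cong₂ _+_ (𝟙-no (λ x≗f → All.lookup x≢xs y∈ (same-action {x} {y} x≗f y≗f)) (x actsAs? f))
                                     (count xs! f∈xs)

  ∼-intro : ∀ {g v w} → g ∈ elems → act g v ≡ w → v ∼ w
  ∼-intro = lose

  InG⇒∼ : ∀ {f v w} → InG f → map f v ≡ w → v ∼ w
  InG⇒∼ {v = v} F fv≡w with find F
  ... | g , g∈ , g≗f = ∼-intro g∈ (≡.trans (ListP.map-cong g≗f v) fv≡w)

  ∼-sym : ∀ {v w} → v ∼ w → w ∼ v
  ∼-sym v∼w with find v∼w
  ... | g , g∈ , ≡.refl = InG⇒∼ (InG-inverse g∈)
    (≡.trans (≡.sym (ListP.map-∘ _)) (≡.trans (ListP.map-cong (λ _ → inverseˡ g) _) (ListP.map-id _)))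

  ∼-trans : ∀ {u v w} → u ∼ v → v ∼ w → u ∼ w
  ∼-trans {u} u∼v v∼w with find u∼v | find v∼w
  ... | g , g∈ , ≡.refl | h , h∈ , ≡.refl = InG⇒∼ (InG-∘ (InG-∈ h∈) (InG-∈ g∈)) (ListP.map-∘ u)

  ∼-length : ∀ {v w} → v ∼ w → length v ≡ length w
  ∼-length {v} v∼w with find v∼w
  ... | g , _ , ≡.refl = ≡.sym (ListP.length-map (g ⟨$⟩ʳ_) v)

  ∑-reindex : (φ ψ : Perm → Fin q → Fin q) →
              (∀ {g} → g ∈ elems → InG (φ g)) → (∀ {k} → k ∈ elems → InG (ψ k)) →
              (∀ g k → k actsAs φ g ⇔ g actsAs ψ k) →
              (F H : Perm → ℕ) → (∀ g k → k actsAs φ g → F g ≡ H k) → ∑ F elems ≡ ∑ H elems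
  ∑-reindex φ ψ InG-φ InG-ψ φ⇔ψ F H F≡H = begin
    ∑ F elems
      ≡⟨ ∑-cong-∈ elems (λ g∈ → ≡.sym (spread (count-actsAs (InG-φ g∈)))) ⟩
    ∑ (λ g → ∑ (λ k → 𝟙 (k actsAs? φ g) * F g) elems) elems
      ≡⟨ ∑-cong elems (λ g → ∑-cong elems (λ k → 𝟙-*-cong (F≡H g k) (k actsAs? φ g))) ⟩
    ∑ (λ g → ∑ (λ k → 𝟙 (k actsAs? φ g) * H k) elems) elems
      ≡⟨ ∑-swap _ elems elems ⟩
    ∑ (λ k → ∑ (λ g → 𝟙 (k actsAs? φ g) * H k) elems) elems
      ≡⟨ ∑-cong elems (λ k → ∑-cong elems (λ g →
           ≡.cong (_* H k) (𝟙-cong (φ⇔ψ g k) (k actsAs? φ g) (g actsAs? ψ k)))) ⟩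
    ∑ (λ k → ∑ (λ g → 𝟙 (g actsAs? ψ k) * H k) elems) elems
      ≡⟨ ∑-cong-∈ elems (λ k∈ → spread (count-actsAs (InG-ψ k∈))) ⟩
    ∑ H elems ∎
    where
    open ≡.≡-Reasoning
    spread : ∀ {c : Perm → ℕ} {x} → ∑ c elems ≡ 1 → ∑ (λ g → c g * x) elems ≡ x
    spread {c} {x} ∑c≡1 = ≡.trans (∑-*ʳ c x elems) (≡.trans (≡.cong (_* x) ∑c≡1) (ℕP.*-identityˡ x))

  stab≡∑ : ∀ x → stab x ≡ ∑ (λ k → 𝟙 (act k x ≟ʷ x)) elems
  stab≡∑ x = length-filter≡∑𝟙 (λ k → act k x ≟ʷ x) elems

  stab-positive : ∀ x → 1 ≤ stab x
  stab-positive x with find has-id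
  ... | e , e∈ , e≗id = begin
    1                                    ≡⟨ 𝟙-yes (≡.trans (ListP.map-cong e≗id x) (ListP.map-id x)) (act e x ≟ʷ x) ⟨
    𝟙 (act e x ≟ʷ x)                     ≤⟨ term≤∑ (λ k → 𝟙 (act k x ≟ʷ x)) e∈ ⟩
    ∑ (λ k → 𝟙 (act k x ≟ʷ x)) elems     ≡⟨ stab≡∑ x ⟨
    stab x                               ∎
    where open ℕP.≤-Reasoning

  order-positive : 1 ≤ order
  order-positive = nonempty has-id
    where
    nonempty : ∀ {P : Perm → Set} {xs} → Any P xs → 1 ≤ length xs
    nonempty (here _)  = s≤s z≤n
    nonempty (there _) = s≤s z≤n

  solutions : Word q → Word q → ℕ
  solutions a y = ∑ (λ g → 𝟙 (act g a ≟ʷ y)) elems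

  -- If g₁·x = a, then g ↦ h ∘ g ∘ g₁ maps the solutions of g·a = y bijectively onto the stabiliser of x.
  count-solutions : ∀ a {x y h} → h ∈ elems → act h y ≡ x → solutions a y ≡ 𝟙 (x ∼? a) * stab x
  count-solutions a {x} {y} {h} h∈ hy≡x with x ∼? a
  ... | no x≁a = ≡.trans
    (∑-cong-∈ elems (λ g∈ → 𝟙-no (λ ga≡y → x≁a (∼-sym (∼-trans (∼-intro g∈ ga≡y) (∼-intro h∈ hy≡x)))) _))
    (∑-zero elems)
  ... | yes x∼a with find x∼a
  ... | g₁ , g₁∈ , ≡.refl = ≡.trans
    (∑-reindex φ ψ (λ g∈ → InG-∘ (InG-∈ h∈) (InG-∘ (InG-∈ g∈) (InG-∈ g₁∈)))
                   (λ k∈ → InG-∘ (InG-inverse h∈) (InG-∘ (InG-∈ k∈) (InG-inverse g₁∈)))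
                   φ⇔ψ _ _ solution⇔fixed)
    (≡.trans (≡.sym (stab≡∑ x)) (≡.sym (ℕP.+-identityʳ (stab x))))
    where
    φ ψ : Perm → Fin q → Fin q
    φ g b = h ⟨$⟩ʳ (g ⟨$⟩ʳ (g₁ ⟨$⟩ʳ b))
    ψ k b = h ⟨$⟩ˡ (k ⟨$⟩ʳ (g₁ ⟨$⟩ˡ b))
    φ⇔ψ : ∀ g k → k actsAs φ g ⇔ g actsAs ψ k
    φ⇔ψ g k = mk⇔
      (λ k≗φg b → ≡.trans (≡.sym (inverseˡ h)) (≡.cong (h ⟨$⟩ˡ_)
        (≡.trans (≡.cong (λ c → h ⟨$⟩ʳ (g ⟨$⟩ʳ c)) (≡.sym (inverseʳ g₁))) (≡.sym (k≗φg (g₁ ⟨$⟩ˡ b))))))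
      (λ g≗ψk b → ≡.sym (≡.trans (≡.cong (h ⟨$⟩ʳ_) (g≗ψk (g₁ ⟨$⟩ʳ b)))
        (≡.trans (inverseʳ h) (≡.cong (k ⟨$⟩ʳ_) (inverseˡ g₁)))))
    solution⇔fixed : ∀ g k → k actsAs φ g → 𝟙 (act g (act g₁ x) ≟ʷ y) ≡ 𝟙 (act k x ≟ʷ x)
    solution⇔fixed g k k≗φg = 𝟙-cong (mk⇔
      (λ ga≡y → ≡.trans kx≡hga (≡.trans (≡.cong (act h) ga≡y) hy≡x))
      (λ kx≡x → act-injective h (≡.trans (≡.sym kx≡hga) (≡.trans kx≡x (≡.sym hy≡x))))) _ _
      where
      kx≡hga : act k x ≡ act h (act g (act g₁ x))
      kx≡hga = ≡.trans (ListP.map-cong k≗φg x) (≡.trans (ListP.map-∘ x) (≡.cong (act h) (ListP.map-∘ x)))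

  ∑-act≡∑-solutions : ∀ (f : Word q → ℕ) {M} a → length a ≡ M →
                      ∑ (λ g → f (act g a)) elems ≡ ∑ (λ y → f y * solutions a y) (allWords q M)
  ∑-act≡∑-solutions f {M} a a-length = begin
    ∑ (λ g → f (act g a)) elems
      ≡⟨ ∑-cong elems (λ g → ∑-allWords-𝟙≡ M (act g a) (≡.trans (ListP.length-map (g ⟨$⟩ʳ_) a) a-length) f) ⟨
    ∑ (λ g → ∑ (λ y → 𝟙 (act g a ≟ʷ y) * f y) (allWords q M)) elems
      ≡⟨ ∑-swap (λ g y → 𝟙 (act g a ≟ʷ y) * f y) elems (allWords q M) ⟩
    ∑ (λ y → ∑ (λ g → 𝟙 (act g a ≟ʷ y) * f y) elems) (allWords q M)
      ≡⟨ ∑-cong (allWords q M) (λ y →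
           ≡.trans (∑-*ʳ (λ g → 𝟙 (act g a ≟ʷ y)) (f y) elems) (ℕP.*-comm (solutions a y) (f y))) ⟩
    ∑ (λ y → f y * solutions a y) (allWords q M) ∎
    where open ≡.≡-Reasoning

module Occurrences {q : ℕ} (G : Subgroup q) where
  open WithGroup G
  open GroupAction G

  StartsWith : Word q → Word q → Set
  StartsWith p t = length p ≤ length t × take (length p) t ∼ p

  startsWith? : ∀ p t → Dec (StartsWith p t)
  startsWith? p t = (length p ℕ.≤? length t) ×-dec (take (length p) t ∼? p)

  EndsWith : Word q → Word q → Set
  EndsWith p w = length p ≤ length w × drop (length w ∸ length p) w ∼ p

  endsWith? : ∀ p w → Dec (EndsWith p w)
  endsWith? p w = (length p ℕ.≤? length w) ×-dec (drop (length w ∸ length p) w ∼? p)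

  endsWith-++ : ∀ p w {v} → v ∼ p → EndsWith p (w ++ v)
  endsWith-++ p w {v} v∼p =
    ℕP.≤-trans (ℕP.m≤n+m (length p) (length w)) (ℕP.≤-reflexive (≡.sym w++v-length)) ,
    ≡.subst (_∼ p) (≡.sym (≡.trans (≡.cong (λ t → drop t (w ++ v)) skip) (drop-++ˡ w v))) v∼p
    where
    w++v-length : length (w ++ v) ≡ length w + length p
    w++v-length = ≡.trans (ListP.length-++ w) (≡.cong (_+_ (length w)) (∼-length v∼p))
    skip : length (w ++ v) ∸ length p ≡ length w
    skip = ≡.trans (≡.cong (_∸ length p) w++v-length) (ℕP.m+n∸n≡m (length w) (length p))

  startsWith-++ : ∀ p {u} v → length p ≤ length u → StartsWith p (u ++ v) ⇔ StartsWith p u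
  startsWith-++ p {u} v ℓ≤u = mk⇔
    (λ (_ , s) → ℓ≤u , ≡.subst (_∼ p) (take-++ˡ (length p) u v ℓ≤u) s)
    (λ (_ , s) → ℕP.≤-trans ℓ≤u (ListP.length-++-≤ˡ u) , ≡.subst (_∼ p) (≡.sym (take-++ˡ (length p) u v ℓ≤u)) s)

  endsWith-∷ : ∀ p x {w} → length p ≤ length w → EndsWith p w ⇔ EndsWith p (x ∷ w)
  endsWith-∷ p x {w} ℓ≤w = mk⇔
    (λ (_ , s) → ℕP.m≤n⇒m≤1+n ℓ≤w , ≡.subst (λ n → drop n (x ∷ w) ∼ p) (≡.sym (ℕP.+-∸-assoc 1 ℓ≤w)) s)
    (λ (_ , s) → ℓ≤w , ≡.subst (λ n → drop n (x ∷ w) ∼ p) (ℕP.+-∸-assoc 1 ℓ≤w) s)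

  startsWith⇔endsWith : ∀ p {w} → length w ≤ length p → StartsWith p w ⇔ EndsWith p w
  startsWith⇔endsWith p {w} w≤ℓ =
    mk⇔ (map₂ (≡.subst (_∼ p) take≡drop)) (map₂ (≡.subst (_∼ p) (≡.sym take≡drop)))
    where
    take≡drop : take (length p) w ≡ drop (length w ∸ length p) w
    take≡drop = ≡.trans (ListP.take-all (length p) w w≤ℓ) (≡.cong (λ n → drop n w) (≡.sym (ℕP.m≤n⇒m∸n≡0 w≤ℓ)))

  starts ends : Word q → Word q → ℕ
  starts p t = 𝟙 (startsWith? p t)
  ends   p w = 𝟙 (endsWith? p w)

  -- Appending a letter to x ∷ w changes only the occurrence starting at x and the one at the end.
  starts+ends-∷ʳ : ∀ p x w a → starts p (x ∷ w ∷ʳ a) + ends p (w ∷ʳ a) ≡ starts p (x ∷ w) + ends p (x ∷ w ∷ʳ a)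
  starts+ends-∷ʳ p x w a with ℕP.≤-<-connex (length p) (suc (length w))
  ... | inj₁ ℓ≤xw = ≡.cong₂ _+_
    (𝟙-cong (startsWith-++ p (a ∷ []) ℓ≤xw) (startsWith? p (x ∷ w ∷ʳ a)) (startsWith? p (x ∷ w)))
    (𝟙-cong (endsWith-∷ p x (ℕP.≤-trans ℓ≤xw (ℕP.≤-reflexive (≡.sym (length-∷ʳ w a)))))
            (endsWith? p (w ∷ʳ a)) (endsWith? p (x ∷ w ∷ʳ a)))
  ... | inj₂ xw<ℓ = begin
    starts p (x ∷ w ∷ʳ a) + ends p (w ∷ʳ a)
      ≡⟨ ≡.cong₂ _+_ (𝟙-cong (startsWith⇔endsWith p whole≤ℓ) (startsWith? p (x ∷ w ∷ʳ a)) (endsWith? p (x ∷ w ∷ʳ a)))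
                     (𝟙-no (λ (ℓ≤wa , _) → ℕP.<⇒≱ xw<ℓ (ℕP.≤-trans ℓ≤wa (ℕP.≤-reflexive (length-∷ʳ w a))))
                           (endsWith? p (w ∷ʳ a))) ⟩
    ends p (x ∷ w ∷ʳ a) + 0                  ≡⟨ ℕP.+-comm _ 0 ⟩
    0 + ends p (x ∷ w ∷ʳ a)                  ≡⟨ ≡.cong (_+ ends p (x ∷ w ∷ʳ a)) starts≡0 ⟨
    starts p (x ∷ w) + ends p (x ∷ w ∷ʳ a)   ∎
    where
    open ≡.≡-Reasoning
    whole≤ℓ : length (x ∷ w ∷ʳ a) ≤ length p
    whole≤ℓ = ℕP.≤-trans (ℕP.≤-reflexive (≡.cong suc (length-∷ʳ w a))) xw<ℓ
    starts≡0 : starts p (x ∷ w) ≡ 0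
    starts≡0 = 𝟙-no (ℕP.<⇒≱ xw<ℓ ∘ proj₁) (startsWith? p (x ∷ w))

  ∑starts : Word q → Word q → ℕ
  ∑starts p w = ∑ (starts p) (tails w)

  ∑starts-∷ʳ : ∀ p → 1 ≤ length p → ∀ w a → ∑starts p (w ∷ʳ a) ≡ ∑starts p w + ends p (w ∷ʳ a)
  ∑starts-∷ʳ p 1≤ℓ [] a = begin
    starts p (a ∷ []) + (starts p [] + 0)
      ≡⟨ ≡.cong₂ _+_ (𝟙-cong (startsWith⇔endsWith p 1≤ℓ) (startsWith? p (a ∷ [])) (endsWith? p (a ∷ [])))
                     (≡.cong (_+ 0) starts[]≡0) ⟩
    ends p (a ∷ []) + 0                     ≡⟨ ℕP.+-comm _ 0 ⟩
    0 + ends p (a ∷ [])                     ≡⟨ ≡.cong (λ n → n + 0 + ends p (a ∷ [])) starts[]≡0 ⟨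
    starts p [] + 0 + ends p (a ∷ [])       ∎
    where
    open ≡.≡-Reasoning
    starts[]≡0 : starts p [] ≡ 0
    starts[]≡0 = 𝟙-no (λ (ℓ≤0 , _) → ℕP.<⇒≱ 1≤ℓ ℓ≤0) (startsWith? p [])
  ∑starts-∷ʳ p 1≤ℓ (x ∷ w) a = begin
    starts p (x ∷ w ∷ʳ a) + ∑starts p (w ∷ʳ a)
      ≡⟨ ≡.cong (_+_ (starts p (x ∷ w ∷ʳ a))) (∑starts-∷ʳ p 1≤ℓ w a) ⟩
    starts p (x ∷ w ∷ʳ a) + (∑starts p w + ends p (w ∷ʳ a))
      ≡⟨ ℕ-x∙yz≈y∙xz (starts p (x ∷ w ∷ʳ a)) (∑starts p w) (ends p (w ∷ʳ a)) ⟩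
    ∑starts p w + (starts p (x ∷ w ∷ʳ a) + ends p (w ∷ʳ a))
      ≡⟨ ≡.cong (_+_ (∑starts p w)) (starts+ends-∷ʳ p x w a) ⟩
    ∑starts p w + (starts p (x ∷ w) + ends p (x ∷ w ∷ʳ a))
      ≡⟨ ℕ-x∙yz≈yx∙z (∑starts p w) (starts p (x ∷ w)) (ends p (x ∷ w ∷ʳ a)) ⟩
    starts p (x ∷ w) + ∑starts p w + ends p (x ∷ w ∷ʳ a) ∎
    where open ≡.≡-Reasoning

  occ-∷ʳ : ∀ p → 1 ≤ length p → ∀ w a → occ p (w ∷ʳ a) ≡ occ p w + ends p (w ∷ʳ a)
  occ-∷ʳ p 1≤ℓ w a = begin
    occ p (w ∷ʳ a)                ≡⟨ length-filter≡∑𝟙 (startsWith? p) (tails (w ∷ʳ a)) ⟩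
    ∑starts p (w ∷ʳ a)            ≡⟨ ∑starts-∷ʳ p 1≤ℓ w a ⟩
    ∑starts p w + ends p (w ∷ʳ a) ≡⟨ ≡.cong (_+ ends p (w ∷ʳ a)) (length-filter≡∑𝟙 (startsWith? p) (tails w)) ⟨
    occ p w + ends p (w ∷ʳ a)     ∎
    where open ≡.≡-Reasoning

  endsWith⇒occ : ∀ p → 1 ≤ length p → ∀ {w} → EndsWith p w → 1 ≤ occ p w
  endsWith⇒occ p 1≤ℓ {w} e with List.initLast w
  ... | []       = contradiction (ℕP.≤-trans 1≤ℓ (proj₁ e)) λ ()
  ... | w′ ∷ʳ′ a = begin
    1                             ≡⟨ 𝟙-yes e (endsWith? p (w′ ∷ʳ a)) ⟨
    ends p (w′ ∷ʳ a)              ≤⟨ ℕP.m≤n+m _ (occ p w′) ⟩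
    occ p w′ + ends p (w′ ∷ʳ a)   ≡⟨ occ-∷ʳ p 1≤ℓ w′ a ⟨
    occ p (w′ ∷ʳ a)               ∎
    where open ℕP.≤-Reasoning

module Avoidance {q : ℕ} (G : Subgroup q) {k : ℕ} (ps : Fin k → Word q)
                 (1≤ℓ : ∀ i → 1 ≤ length (ps i)) (reduced : WithGroup.WithPatterns.Reduced G ps) where
  open Subgroup G
  open WithGroup G
  open WithPatterns ps
  open GroupAction G
  open Occurrences G

  factor-of-other-pattern : ∀ {i j} → i ≢ j → ∀ {u v v′} →
                            u ∼ ps i → Factor u v → v ∼ v′ → Factor v′ (ps j) → ⊥
  factor-of-other-pattern {i} {j} i≢j {u} u∼pᵢ u⊑v v∼v′ v′⊑pⱼ with find v∼v′
  ... | g , g∈ , ≡.refl =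
    reduced i j i≢j (act g u) (factor-trans (factor-map (g ⟨$⟩ʳ_) u⊑v) v′⊑pⱼ)
            (∼-trans (∼-sym (∼-intro g∈ ≡.refl)) u∼pᵢ)

  endsWith-unique : ∀ w {i j} → i ≢ j → EndsWith (ps i) w → ¬ EndsWith (ps j) w
  endsWith-unique w {i} {j} i≢j (ℓᵢ≤w , sᵢ) (ℓⱼ≤w , sⱼ) with ℕP.≤-total (ℓ i) (ℓ j)
  ... | inj₁ ℓᵢ≤ℓⱼ =
    factor-of-other-pattern i≢j sᵢ (suffix-factor w ℓᵢ≤ℓⱼ ℓⱼ≤w) sⱼ (factor-refl (ps j))
  ... | inj₂ ℓⱼ≤ℓᵢ =
    factor-of-other-pattern (i≢j ∘ ≡.sym) sⱼ (suffix-factor w ℓⱼ≤ℓᵢ ℓᵢ≤w) sᵢ (factor-refl (ps i))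

  newOcc : Word q → ℕ
  newOcc w = ∑ (λ i → ends (ps i) w) (allFin k)

  newOcc≤1 : ∀ w → newOcc w ≤ 1
  newOcc≤1 w = ∑𝟙-exclusive (λ i → endsWith? (ps i) w) (allFin⁺ k) (endsWith-unique w)

  totalOcc-∷ʳ : ∀ w a → totalOcc (w ∷ʳ a) ≡ totalOcc w + newOcc (w ∷ʳ a)
  totalOcc-∷ʳ w a = ≡.trans (∑-cong (allFin k) (λ i → occ-∷ʳ (ps i) (1≤ℓ i) w a))
                            (∑-+ (λ i → occ (ps i) w) (λ i → ends (ps i) (w ∷ʳ a)) (allFin k))

  avoids : Word q → ℕ
  avoids w = 𝟙 (totalOcc w ℕ.≟ 0)

  onlyAtEnd : Fin k → Word q → ℕ
  onlyAtEnd i w = 𝟙 ((totalOcc w ℕ.≟ 1) ×-dec endsWith? (ps i) w)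

  onlyAtEnd∑ : Word q → ℕ
  onlyAtEnd∑ w = ∑ (λ i → onlyAtEnd i w) (allFin k)

  onlyAtEnd∑≡ : ∀ w → onlyAtEnd∑ w ≡ 𝟙 (totalOcc w ℕ.≟ 1) * newOcc w
  onlyAtEnd∑≡ w = ≡.trans (∑-cong (allFin k) (λ i → 𝟙-× (totalOcc w ℕ.≟ 1) (endsWith? (ps i) w)))
                          (∑-*ˡ (𝟙 (totalOcc w ℕ.≟ 1)) (λ i → ends (ps i) w) (allFin k))

  -- If u avoids, u ∷ʳ a either avoids or has a single occurrence, at its end: newOcc ≤ 1 by reducedness.
  avoids-∷ʳ : ∀ u a → avoids (u ∷ʳ a) + onlyAtEnd∑ (u ∷ʳ a) ≡ avoids u
  avoids-∷ʳ u a = begin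
    avoids (u ∷ʳ a) + onlyAtEnd∑ (u ∷ʳ a)
      ≡⟨ ≡.cong (_+_ (avoids (u ∷ʳ a))) (onlyAtEnd∑≡ (u ∷ʳ a)) ⟩
    𝟙 (totalOcc (u ∷ʳ a) ℕ.≟ 0) + 𝟙 (totalOcc (u ∷ʳ a) ℕ.≟ 1) * newOcc (u ∷ʳ a)
      ≡⟨ ≡.cong (λ t → 𝟙 (t ℕ.≟ 0) + 𝟙 (t ℕ.≟ 1) * newOcc (u ∷ʳ a)) (totalOcc-∷ʳ u a) ⟩
    𝟙 (totalOcc u + newOcc (u ∷ʳ a) ℕ.≟ 0) + 𝟙 (totalOcc u + newOcc (u ∷ʳ a) ℕ.≟ 1) * newOcc (u ∷ʳ a)
      ≡⟨ 𝟙≡0-+ (totalOcc u) (newOcc (u ∷ʳ a)) (newOcc≤1 (u ∷ʳ a)) ⟩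
    avoids u ∎
    where open ≡.≡-Reasoning

  avoids-++-≤ : ∀ u v → avoids (u ++ v) ≤ avoids u
  avoids-++-≤ u []      = ℕP.≤-reflexive (≡.cong avoids (ListP.++-identityʳ u))
  avoids-++-≤ u (b ∷ v) = begin
    avoids (u ++ b ∷ v)                     ≡⟨ ≡.cong avoids (ListP.++-assoc u (b ∷ []) v) ⟨
    avoids (u ∷ʳ b ++ v)                    ≤⟨ avoids-++-≤ (u ∷ʳ b) v ⟩
    avoids (u ∷ʳ b)                         ≤⟨ ℕP.m≤m+n _ _ ⟩
    avoids (u ∷ʳ b) + onlyAtEnd∑ (u ∷ʳ b)   ≡⟨ avoids-∷ʳ u b ⟩
    avoids u                                ∎
    where open ℕP.≤-Reasoning

  avoids-telescope : ∀ u v → avoids u ∸ avoids (u ++ v) ≡ ∑[ m < length v ] onlyAtEnd∑ (u ++ take (suc m) v)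
  avoids-telescope u [] =
    ≡.trans (≡.cong (λ w → avoids u ∸ avoids w) (ListP.++-identityʳ u)) (ℕP.n∸n≡0 (avoids u))
  avoids-telescope u (b ∷ v) = begin
    avoids u ∸ avoids (u ++ b ∷ v)
      ≡⟨ ≡.cong (λ w → avoids u ∸ avoids w) (ListP.++-assoc u (b ∷ []) v) ⟨
    avoids u ∸ avoids (u ∷ʳ b ++ v)
      ≡⟨ ∸-telescope (avoids-++-≤ (u ∷ʳ b) v) (avoids-++-≤ u (b ∷ [])) ⟨
    (avoids u ∸ avoids (u ∷ʳ b)) + (avoids (u ∷ʳ b) ∸ avoids (u ∷ʳ b ++ v))
      ≡⟨ ≡.cong₂ _+_ first-step (avoids-telescope (u ∷ʳ b) v) ⟩
    onlyAtEnd∑ (u ∷ʳ b) + ∑[ m < length v ] onlyAtEnd∑ (u ∷ʳ b ++ take (suc m) v)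
      ≡⟨ ≡.cong (_+_ (onlyAtEnd∑ (u ∷ʳ b)))
                (∑<-cong (length v) (λ m _ → ≡.cong onlyAtEnd∑ (ListP.++-assoc u (b ∷ []) (take (suc m) v)))) ⟩
    onlyAtEnd∑ (u ++ b ∷ []) + ∑[ m < length v ] onlyAtEnd∑ (u ++ b ∷ take (suc m) v) ∎
    where
    open ≡.≡-Reasoning
    first-step : avoids u ∸ avoids (u ∷ʳ b) ≡ onlyAtEnd∑ (u ∷ʳ b)
    first-step = ≡.trans (≡.cong (_∸ avoids (u ∷ʳ b)) (≡.sym (avoids-∷ʳ u b)))
                         (ℕP.m+n∸m≡n (avoids (u ∷ʳ b)) (onlyAtEnd∑ (u ∷ʳ b)))

  avoidCount≡∑ : ∀ n → avoidCount n ≡ ∑ avoids (allWords q n)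
  avoidCount≡∑ n = length-filter≡∑𝟙 (λ w → totalOcc w ℕ.≟ 0) (allWords q n)

  endCount≡∑ : ∀ i n → endCount i n ≡ ∑ (onlyAtEnd i) (allWords q n)
  endCount≡∑ i n = ≡.trans (length-filter≡∑𝟙 atLength (allWords q n))
                           (∑-cong-∈ (allWords q n) (λ w∈ → atLength≡ _ (All.lookup (allWords-length n) w∈)))
    where
    atLength : ∀ w → Dec _
    atLength w = (totalOcc w ℕ.≟ 1) ×-dec ((ℓ i ℕ.≤? n) ×-dec (drop (n ∸ ℓ i) w ∼? ps i))
    atLength≡ : ∀ w → length w ≡ n → 𝟙 (atLength w) ≡ onlyAtEnd i w
    atLength≡ w ≡.refl = ≡.refl

  recurrence₁ : ∀ n → avoidCount (suc n) + ∑ (λ i → endCount i (suc n)) (allFin k) ≡ q * avoidCount n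
  recurrence₁ n = begin
    avoidCount (suc n) + ∑ (λ i → endCount i (suc n)) (allFin k)
      ≡⟨ ≡.cong₂ _+_ (avoidCount≡∑ (suc n)) (≡.trans (∑-cong (allFin k) (λ i → endCount≡∑ i (suc n)))
                                                     (∑-swap onlyAtEnd (allFin k) (allWords q (suc n)))) ⟩
    ∑ avoids (allWords q (suc n)) + ∑ onlyAtEnd∑ (allWords q (suc n))
      ≡⟨ ∑-+ avoids onlyAtEnd∑ (allWords q (suc n)) ⟨
    ∑ (λ w → avoids w + onlyAtEnd∑ w) (allWords q (suc n))
      ≡⟨ ∑-allWords-∷ʳ n (λ w → avoids w + onlyAtEnd∑ w) ⟩
    ∑ (λ u → ∑ (λ a → avoids (u ∷ʳ a) + onlyAtEnd∑ (u ∷ʳ a)) (allFin q)) (allWords q n)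
      ≡⟨ ∑-cong (allWords q n) (λ u → ≡.trans (∑-cong (allFin q) (avoids-∷ʳ u)) (∑-const (avoids u) (allFin q))) ⟩
    ∑ (λ u → length (allFin q) * avoids u) (allWords q n)
      ≡⟨ ∑-*ˡ (length (allFin q)) avoids (allWords q n) ⟩
    length (allFin q) * ∑ avoids (allWords q n)
      ≡⟨ ≡.cong₂ _*_ (ListP.length-tabulate {n = q} id) (≡.sym (avoidCount≡∑ n)) ⟩
    q * avoidCount n ∎
    where open ≡.≡-Reasoning

  endsWith⇒occurs : ∀ i w → EndsWith (ps i) w → 1 ≤ totalOcc w
  endsWith⇒occurs i w e =
    ℕP.≤-trans (endsWith⇒occ (ps i) (1≤ℓ i) e) (term≤∑ (λ i → occ (ps i) w) (∈-allFin i))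

  correlationCount : Fin k → Fin k → ℕ → ℕ
  correlationCount j i s = 𝟙 (drop s (ps i) ∼? take (ℓ i ∸ s) (ps j)) * stab (drop s (ps i))

  -- The number of g ∈ G mapping the prefix of length M of p_j onto the suffix of length M of p_i.
  overlapCount : Fin k → Fin k → ℕ → ℕ
  overlapCount j i M = 𝟙 (M ℕ.≤? ℓ i) * correlationCount j i (ℓ i ∸ M)

  overlapCount≡0 : ∀ j i M → (M ≤ ℓ i → ℓ j < M) → overlapCount j i M ≡ 0
  overlapCount≡0 j i M too-long with ℕP.≤-<-connex M (ℓ i)
  ... | inj₂ ℓᵢ<M = ≡.cong (_* correlationCount j i (ℓ i ∸ M)) (𝟙-no (ℕP.<⇒≱ ℓᵢ<M) (M ℕ.≤? ℓ i))
  ... | inj₁ M≤ℓᵢ = ≡.trans (≡.cong (𝟙 (M ℕ.≤? ℓ i) *_) (≡.cong (_* stab x) (𝟙-no lengths-differ (x ∼? y))))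
                            (ℕP.*-zeroʳ (𝟙 (M ℕ.≤? ℓ i)))
    where
    x = drop (ℓ i ∸ M) (ps i)
    y = take (ℓ i ∸ (ℓ i ∸ M)) (ps j)
    lengths-differ : ¬ (x ∼ y)
    lengths-differ x∼y = ℕP.<⇒≱ (too-long M≤ℓᵢ) (begin
      M                      ≡⟨ ℕP.m∸[m∸n]≡n M≤ℓᵢ ⟨
      ℓ i ∸ (ℓ i ∸ M)        ≡⟨ ListP.length-drop (ℓ i ∸ M) (ps i) ⟨
      length x               ≡⟨ ∼-length x∼y ⟩
      length y               ≡⟨ ListP.length-take (ℓ i ∸ (ℓ i ∸ M)) (ps j) ⟩
      (ℓ i ∸ (ℓ i ∸ M)) ℕ.⊓ ℓ j  ≤⟨ ℕP.m⊓n≤n (ℓ i ∸ (ℓ i ∸ M)) (ℓ j) ⟩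
      ℓ j                    ∎)
      where open ℕP.≤-Reasoning

  -- If ℓ_i < M, the occurrence of p_i at the end of u lies inside y = drop n u, so y cannot be an image of
  -- a prefix of p_j: that would make p_i equivalent to a factor of p_j, contradicting reducedness.
  solutions-at-end : ∀ j i {M n u} → M ≤ ℓ j → length u ≡ n + M → EndsWith (ps i) u →
                     solutions (take M (ps j)) (drop n u) ≡ overlapCount j i M
  solutions-at-end j i {M} {n} {u} M≤ℓⱼ u-length (ℓᵢ≤u , z∼pᵢ) with find z∼pᵢ | ℕP.≤-<-connex M (ℓ i)
  ... | h , h∈ , hz≡pᵢ | inj₁ M≤ℓᵢ = begin
    solutions (take M (ps j)) (drop n u)
      ≡⟨ count-solutions (take M (ps j)) h∈ hy≡x ⟩
    𝟙 (x ∼? take M (ps j)) * stab x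
      ≡⟨ ≡.cong (λ t → 𝟙 (x ∼? take t (ps j)) * stab x) (ℕP.m∸[m∸n]≡n M≤ℓᵢ) ⟨
    correlationCount j i (ℓ i ∸ M)
      ≡⟨ ℕP.*-identityˡ _ ⟨
    1 * correlationCount j i (ℓ i ∸ M)
      ≡⟨ ≡.cong (_* correlationCount j i (ℓ i ∸ M)) (𝟙-yes M≤ℓᵢ (M ℕ.≤? ℓ i)) ⟨
    overlapCount j i M ∎
    where
    open ≡.≡-Reasoning
    x = drop (ℓ i ∸ M) (ps i)
    hy≡x : act h (drop n u) ≡ x
    hy≡x = begin
      act h (drop n u)                                     ≡⟨ ≡.cong (λ t → act h (drop t u)) n≡ ⟩
      act h (drop ((length u ∸ ℓ i) + (ℓ i ∸ M)) u)        ≡⟨ ≡.cong (act h) (ListP.drop-drop (length u ∸ ℓ i) (ℓ i ∸ M) u) ⟨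
      act h (drop (ℓ i ∸ M) (drop (length u ∸ ℓ i) u))     ≡⟨ ListP.drop-map (ℓ i ∸ M) _ ⟨
      drop (ℓ i ∸ M) (act h (drop (length u ∸ ℓ i) u))     ≡⟨ ≡.cong (drop (ℓ i ∸ M)) hz≡pᵢ ⟩
      x                                                    ∎
      where
      n≡ : n ≡ (length u ∸ ℓ i) + (ℓ i ∸ M)
      n≡ = ≡.sym (≡.trans (∸-telescope M≤ℓᵢ ℓᵢ≤u) (≡.trans (≡.cong (_∸ M) u-length) (ℕP.m+n∸n≡m n M)))
  ... | h , h∈ , hz≡pᵢ | inj₂ ℓᵢ<M = ≡.trans
    (≡.trans (∑-cong-∈ elems (λ g∈ → 𝟙-no (no-solution g∈) _)) (∑-zero elems))
    (≡.sym (overlapCount≡0 j i M (λ M≤ℓᵢ → contradiction M≤ℓᵢ (ℕP.<⇒≱ ℓᵢ<M))))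
    where
    y = drop n u
    z = drop (length u ∸ ℓ i) u
    z⊑y : Factor z y
    z⊑y = ≡.subst (λ t → Factor t y)
      (≡.trans (ListP.drop-drop n (M ∸ ℓ i) u) (≡.cong (λ t → drop t u)
        (≡.sym (≡.trans (≡.cong (_∸ ℓ i) u-length) (ℕP.+-∸-assoc n (ℕP.<⇒≤ ℓᵢ<M))))))
      (drop-factor (M ∸ ℓ i) y)
    no-solution : ∀ {g} → g ∈ elems → ¬ (act g (take M (ps j)) ≡ y)
    no-solution g∈ ga≡y with i FinP.≟ j
    ... | yes ≡.refl = ℕP.<⇒≱ ℓᵢ<M M≤ℓⱼ
    ... | no i≢j = factor-of-other-pattern i≢j z∼pᵢ z⊑y (∼-sym (∼-intro g∈ ga≡y)) (take-factor M (ps j))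

  avoids≡∑onlyAtEnd : ∀ j w {g} → g ∈ elems →
                      avoids w ≡ ∑[ m < ℓ j ] onlyAtEnd∑ (w ++ act g (take (suc m) (ps j)))
  avoids≡∑onlyAtEnd j w {g} g∈ = begin
    avoids w
      ≡⟨ ≡.cong (avoids w ∸_) w++v-occurs ⟨
    avoids w ∸ avoids (w ++ v)
      ≡⟨ avoids-telescope w v ⟩
    ∑[ m < length v ] onlyAtEnd∑ (w ++ take (suc m) v)
      ≡⟨ ≡.cong (λ L → ∑< L (λ m → onlyAtEnd∑ (w ++ take (suc m) v))) (ListP.length-map (g ⟨$⟩ʳ_) (ps j)) ⟩
    ∑[ m < ℓ j ] onlyAtEnd∑ (w ++ take (suc m) v)
      ≡⟨ ∑<-cong (ℓ j) (λ m _ → ≡.cong (λ t → onlyAtEnd∑ (w ++ t)) (ListP.take-map (suc m) (ps j))) ⟩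
    ∑[ m < ℓ j ] onlyAtEnd∑ (w ++ act g (take (suc m) (ps j))) ∎
    where
    open ≡.≡-Reasoning
    v = act g (ps j)
    w++v-occurs : avoids (w ++ v) ≡ 0
    w++v-occurs = 𝟙-no (λ tot≡0 → ℕP.<⇒≱ (endsWith⇒occurs j (w ++ v) (endsWith-++ (ps j) w (∼-sym (∼-intro g∈ ≡.refl))))
                                          (ℕP.≤-reflexive tot≡0))
                       (totalOcc (w ++ v) ℕ.≟ 0)

  layer : ∀ j n M → M ≤ ℓ j →
          ∑ (λ w → ∑ (λ g → onlyAtEnd∑ (w ++ act g (take M (ps j)))) elems) (allWords q n)
          ≡ ∑ (λ i → endCount i (n + M) * overlapCount j i M) (allFin k)
  layer j n M M≤ℓⱼ = begin
    ∑ (λ w → ∑ (λ g → onlyAtEnd∑ (w ++ act g a)) elems) (allWords q n)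
      ≡⟨ ∑-cong (allWords q n) (λ w → ∑-act≡∑-solutions (λ y → onlyAtEnd∑ (w ++ y)) a a-length) ⟩
    ∑ (λ w → ∑ (λ y → onlyAtEnd∑ (w ++ y) * solutions a y) (allWords q M)) (allWords q n)
      ≡⟨ ∑-cong-∈ (allWords q n) (λ {w} w∈ → ∑-cong (allWords q M) (λ y →
           ≡.cong (λ t → onlyAtEnd∑ (w ++ y) * solutions a t) (≡.sym (drop-prefix w∈ y)))) ⟩
    ∑ (λ w → ∑ (λ y → onlyAtEnd∑ (w ++ y) * solutions a (drop n (w ++ y))) (allWords q M)) (allWords q n)
      ≡⟨ ∑-allWords-++ n M (λ u → onlyAtEnd∑ u * solutions a (drop n u)) ⟨
    ∑ (λ u → onlyAtEnd∑ u * solutions a (drop n u)) (allWords q (n + M))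
      ≡⟨ ∑-cong (allWords q (n + M)) (λ u → ≡.sym (∑-*ʳ (λ i → onlyAtEnd i u) (solutions a (drop n u)) (allFin k))) ⟩
    ∑ (λ u → ∑ (λ i → onlyAtEnd i u * solutions a (drop n u)) (allFin k)) (allWords q (n + M))
      ≡⟨ ∑-swap (λ u i → onlyAtEnd i u * solutions a (drop n u)) (allWords q (n + M)) (allFin k) ⟩
    ∑ (λ i → ∑ (λ u → onlyAtEnd i u * solutions a (drop n u)) (allWords q (n + M))) (allFin k)
      ≡⟨ ∑-cong (allFin k) (λ i → ∑-cong-∈ (allWords q (n + M)) (λ {u} u∈ →
           𝟙-*-cong (λ (_ , e) → solutions-at-end j i M≤ℓⱼ (All.lookup (allWords-length (n + M)) u∈) e)
                    ((totalOcc u ℕ.≟ 1) ×-dec endsWith? (ps i) u))) ⟩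
    ∑ (λ i → ∑ (λ u → onlyAtEnd i u * overlapCount j i M) (allWords q (n + M))) (allFin k)
      ≡⟨ ∑-cong (allFin k) (λ i → ≡.trans (∑-*ʳ (onlyAtEnd i) (overlapCount j i M) (allWords q (n + M)))
                                          (≡.cong (_* overlapCount j i M) (≡.sym (endCount≡∑ i (n + M))))) ⟩
    ∑ (λ i → endCount i (n + M) * overlapCount j i M) (allFin k) ∎
    where
    open ≡.≡-Reasoning
    a = take M (ps j)
    a-length : length a ≡ M
    a-length = ≡.trans (ListP.length-take M (ps j)) (ℕP.m≤n⇒m⊓n≡m M≤ℓⱼ)
    drop-prefix : ∀ {w} → w ∈ allWords q n → ∀ y → drop n (w ++ y) ≡ y
    drop-prefix {w} w∈ y = ≡.trans (≡.cong (λ t → drop t (w ++ y)) (≡.sym (All.lookup (allWords-length n) w∈)))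
                                   (drop-++ˡ w y)

  overlaps≡correlations : ∀ j i n →
    ∑[ m < ℓ j ] (endCount i (n + suc m) * overlapCount j i (suc m)) ≡
    ∑[ s < ℓ i ] (correlationCount j i s * endCount i (n + (ℓ i ∸ s)))
  overlaps≡correlations j i n = begin
    ∑< (ℓ j) term             ≡⟨ ∑<-length-irrelevant term (ℓ j) (ℓ i) beyond-ℓⱼ beyond-ℓᵢ ⟩
    ∑< (ℓ i) term             ≡⟨ ∑<-reverse term (ℓ i) ⟩
    ∑[ s < ℓ i ] term (ℓ i ∸ suc s)
      ≡⟨ ∑<-cong (ℓ i) (λ s s<ℓᵢ → reindexed s (ℕP.<⇒≤ s<ℓᵢ) _ (≡.sym (ℕP.+-∸-assoc 1 s<ℓᵢ))) ⟩
    ∑[ s < ℓ i ] (correlationCount j i s * endCount i (n + (ℓ i ∸ s))) ∎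
    where
    open ≡.≡-Reasoning
    term : ℕ → ℕ
    term m = endCount i (n + suc m) * overlapCount j i (suc m)
    vanishes : ∀ m → (suc m ≤ ℓ i → ℓ j < suc m) → term m ≡ 0
    vanishes m too-long = ≡.trans (≡.cong (endCount i (n + suc m) *_) (overlapCount≡0 j i (suc m) too-long))
                                  (ℕP.*-zeroʳ (endCount i (n + suc m)))
    beyond-ℓⱼ : ∀ m → ℓ j ≤ m → term m ≡ 0
    beyond-ℓⱼ m ℓⱼ≤m = vanishes m (λ _ → s≤s ℓⱼ≤m)
    beyond-ℓᵢ : ∀ m → ℓ i ≤ m → term m ≡ 0
    beyond-ℓᵢ m ℓᵢ≤m = vanishes m (λ m<ℓᵢ → contradiction (ℕP.≤-trans m<ℓᵢ ℓᵢ≤m) ℕP.1+n≰n)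
    reindexed : ∀ s → s ≤ ℓ i → ∀ t → t ≡ ℓ i ∸ s →
                endCount i (n + t) * overlapCount j i t ≡ correlationCount j i s * endCount i (n + (ℓ i ∸ s))
    reindexed s s≤ℓᵢ _ ≡.refl = begin
      endCount i (n + (ℓ i ∸ s)) * (𝟙 (ℓ i ∸ s ℕ.≤? ℓ i) * correlationCount j i (ℓ i ∸ (ℓ i ∸ s)))
        ≡⟨ ≡.cong (λ c → endCount i (n + (ℓ i ∸ s)) * (c * correlationCount j i (ℓ i ∸ (ℓ i ∸ s))))
                  (𝟙-yes (ℕP.m∸n≤m (ℓ i) s) (ℓ i ∸ s ℕ.≤? ℓ i)) ⟩
      endCount i (n + (ℓ i ∸ s)) * (1 * correlationCount j i (ℓ i ∸ (ℓ i ∸ s)))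
        ≡⟨ ≡.cong (λ c → endCount i (n + (ℓ i ∸ s)) * c)
                  (≡.trans (ℕP.*-identityˡ _) (≡.cong (correlationCount j i) (ℕP.m∸[m∸n]≡n s≤ℓᵢ))) ⟩
      endCount i (n + (ℓ i ∸ s)) * correlationCount j i s
        ≡⟨ ℕP.*-comm (endCount i (n + (ℓ i ∸ s))) (correlationCount j i s) ⟩
      correlationCount j i s * endCount i (n + (ℓ i ∸ s)) ∎

  recurrence₂ : ∀ j n → order * avoidCount n ≡
                ∑ (λ i → ∑[ s < ℓ i ] (correlationCount j i s * endCount i (n + (ℓ i ∸ s)))) (allFin k)
  recurrence₂ j n = begin
    order * avoidCount n
      ≡⟨ ≡.cong (order *_) (avoidCount≡∑ n) ⟩
    order * ∑ avoids (allWords q n)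
      ≡⟨ ∑-*ˡ order avoids (allWords q n) ⟨
    ∑ (λ w → order * avoids w) (allWords q n)
      ≡⟨ ∑-cong (allWords q n) (λ w → ≡.sym (∑-const (avoids w) elems)) ⟩
    ∑ (λ w → ∑ (λ g → avoids w) elems) (allWords q n)
      ≡⟨ ∑-cong (allWords q n) (λ w → ∑-cong-∈ elems (avoids≡∑onlyAtEnd j w)) ⟩
    ∑ (λ w → ∑ (λ g → ∑< (ℓ j) (hit w g)) elems) (allWords q n)
      ≡⟨ ∑-cong (allWords q n) (λ w → ∑-∑<-swap (hit w) elems (ℓ j)) ⟩
    ∑ (λ w → ∑[ m < ℓ j ] ∑ (λ g → hit w g m) elems) (allWords q n)
      ≡⟨ ∑-∑<-swap (λ w m → ∑ (λ g → hit w g m) elems) (allWords q n) (ℓ j) ⟩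
    ∑[ m < ℓ j ] ∑ (λ w → ∑ (λ g → hit w g m) elems) (allWords q n)
      ≡⟨ ∑<-cong (ℓ j) (λ m m<ℓⱼ → layer j n (suc m) m<ℓⱼ) ⟩
    ∑[ m < ℓ j ] ∑ (λ i → endCount i (n + suc m) * overlapCount j i (suc m)) (allFin k)
      ≡⟨ ∑-∑<-swap (λ i m → endCount i (n + suc m) * overlapCount j i (suc m)) (allFin k) (ℓ j) ⟨
    ∑ (λ i → ∑[ m < ℓ j ] (endCount i (n + suc m) * overlapCount j i (suc m))) (allFin k)
      ≡⟨ ∑-cong (allFin k) (λ i → overlaps≡correlations j i n) ⟩
    ∑ (λ i → ∑[ s < ℓ i ] (correlationCount j i s * endCount i (n + (ℓ i ∸ s)))) (allFin k) ∎
    where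
    open ≡.≡-Reasoning
    hit : Word q → Perm → ℕ → ℕ
    hit w g m = onlyAtEnd∑ (w ++ act g (take (suc m) (ps j)))

sumS-coeff : ∀ {A : Set} (F : A → Ser) xs z → sumS (map F xs) z ≡ ℚ∑.∑ (λ x → F x z) xs
sumS-coeff F []       z = ≡.refl
sumS-coeff F (x ∷ xs) z = ≡.cong (F x z ℚ.+_) (sumS-coeff F xs z)

polyMul-coeff : ∀ (c : ℕ → ℚ) (g : ℕ → ℕ) L f z →
                polyMul (map c (List.applyUpTo g L)) f z ≡ ℚ∑.∑< L (λ s → c (g s) ℚ.* f (z ℤ.- + s))
polyMul-coeff c g zero    f z = ≡.refl
polyMul-coeff c g (suc L) f z = ≡.cong₂ ℚ._+_
  (≡.cong (λ t → c (g 0) ℚ.* f t) (≡.sym (ℤP.+-identityʳ z)))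
  (≡.trans (polyMul-coeff c (g ∘ suc) L f (z ℤ.- ℤ.1ℤ))
           (ℚ∑.∑<-cong L (λ s _ → ≡.cong (λ t → c (g (suc s)) ℚ.* f t) (shift s))))
  where
  lemma : ∀ z s → (z ℤ.- ℤ.1ℤ) ℤ.- s ≡ z ℤ.- (ℤ.1ℤ ℤ.+ s)
  lemma = solve-∀
  shift : ∀ s → (z ℤ.- ℤ.1ℤ) ℤ.- + s ≡ z ℤ.- + suc s
  shift s = ≡.trans (lemma z (+ s)) (≡.cong (ℤ._-_ z) (≡.sym (ℤP.pos-+ 1 s)))

shifted-index : ∀ n l s → s ≤ l → (+ n ℤ.- - (+ l)) ℤ.- + s ≡ + (n + (l ∸ s))
shifted-index n l s s≤l = begin
  (+ n ℤ.- - (+ l)) ℤ.- + s                   ≡⟨ ≡.cong (λ L → (+ n ℤ.- - L) ℤ.- + s) l≡ ⟩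
  (+ n ℤ.- - (+ s ℤ.+ + (l ∸ s))) ℤ.- + s     ≡⟨ lemma (+ n) (+ s) (+ (l ∸ s)) ⟩
  + n ℤ.+ + (l ∸ s)                           ≡⟨ ℤP.pos-+ n (l ∸ s) ⟨
  + (n + (l ∸ s))                             ∎
  where
  open ≡.≡-Reasoning
  l≡ : + l ≡ + s ℤ.+ + (l ∸ s)
  l≡ = ≡.trans (≡.cong +_ (≡.sym (ℕP.m+[n∸m]≡n s≤l))) (ℤP.pos-+ s (l ∸ s))
  lemma : ∀ N S T → (N ℤ.- - (S ℤ.+ T)) ℤ.- S ≡ N ℤ.+ T
  lemma = solve-∀

shifted-index-negative : ∀ d l s t → (-[1+ d ] ℤ.- - (+ l)) ℤ.- + s ≡ + t → t < l
shifted-index-negative d l s t eq = ℕP.≤-trans (s≤s (ℕP.m≤m+n t s))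
  (ℕP.≤-trans (ℕP.m<m+n (t + s) {suc d} (s≤s z≤n)) (ℕP.≤-reflexive (ℤP.+-injective (begin
    + (t + s + suc d)                                    ≡⟨ ℤP.pos-+ (t + s) (suc d) ⟩
    + (t + s) ℤ.+ + suc d                                ≡⟨ ≡.cong (ℤ._+ + suc d) (ℤP.pos-+ t s) ⟩
    (+ t ℤ.+ + s) ℤ.+ + suc d                            ≡⟨ ≡.cong (λ x → (x ℤ.+ + s) ℤ.+ + suc d) eq ⟨
    (((-[1+ d ] ℤ.- - (+ l)) ℤ.- + s) ℤ.+ + s) ℤ.+ + suc d  ≡⟨ lemma (+ suc d) (+ l) (+ s) ⟩
    + l                                                  ∎))))
  where
  open ≡.≡-Reasoning
  lemma : ∀ D L S → ((((- D) ℤ.- (- L)) ℤ.- S) ℤ.+ S) ℤ.+ D ≡ L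
  lemma = solve-∀

module Series {q : ℕ} (G : Subgroup q) {k : ℕ} (ps : Fin k → Word q)
              (1≤ℓ : ∀ i → 1 ≤ length (ps i)) (reduced : WithGroup.WithPatterns.Reduced G ps) where
  open WithGroup G
  open WithPatterns ps
  open GroupAction G
  open Occurrences G
  open Avoidance G ps 1≤ℓ reduced

  endCount-short : ∀ i t → t < ℓ i → endCount i t ≡ 0
  endCount-short i t t<ℓ = ≡.trans (endCount≡∑ i t) (≡.trans
    (∑-cong-∈ (allWords q t) (λ {w} w∈ → 𝟙-no (λ (_ , ℓ≤w , _) → ℕP.<⇒≱ t<ℓ
      (ℕP.≤-trans ℓ≤w (ℕP.≤-reflexive (All.lookup (allWords-length t) w∈)))) (onlyAtEnd-dec w)))
    (∑-zero (allWords q t)))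
    where
    onlyAtEnd-dec : ∀ w → Dec _
    onlyAtEnd-dec w = (totalOcc w ℕ.≟ 1) ×-dec endsWith? (ps i) w

  GenP-short : ∀ i z → (∀ t → z ≡ + t → t < ℓ i) → GenP i z ≡ 0ℚ
  GenP-short i -[1+ _ ] _     = ≡.refl
  GenP-short i (+ t)    short = ≡.cong ι (endCount-short i t (short t ≡.refl))

  avoidCount-zero : avoidCount 0 ≡ 1
  avoidCount-zero = ≡.trans (avoidCount≡∑ 0) (≡.cong (_+ 0) (𝟙-yes no-occurrence (totalOcc [] ℕ.≟ 0)))
    where
    no-occurrence : totalOcc [] ≡ 0
    no-occurrence = ≡.trans
      (∑-cong (allFin k) (λ i → ≡.trans (length-filter≡∑𝟙 (startsWith? (ps i)) (tails []))
        (≡.cong (_+ 0) (𝟙-no (λ (ℓ≤0 , _) → ℕP.<⇒≱ (1≤ℓ i) ℓ≤0) (startsWith? (ps i) [])))))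
      (∑-zero (allFin k))

  GenP∑-short : ∀ z → (∀ i t → z ≡ + t → t < ℓ i) → sumS (map GenP (allFin k)) z ≡ 0ℚ
  GenP∑-short z short = ≡.trans (sumS-coeff GenP (allFin k) z)
    (≡.trans (ℚ∑.∑-cong (allFin k) (λ i → GenP-short i z (short i))) (ℚ∑.∑-zero (allFin k)))

  first-equation : (polyMul (1ℚ ∷ (-ℚ ((+ q) / 1)) ∷ []) GenS ⊕ sumS (map GenP (allFin k))) ≈S oneS
  first-equation (+ zero) = ≡.cong₂ ℚ._+_
    (≡.cong₂ (λ a x → 1ℚ ℚ.* ι a ℚ.+ (x ℚ.+ 0ℚ)) avoidCount-zero (ℚP.*-zeroʳ (-ℚ ((+ q) / 1))))
    (GenP∑-short (+ 0) (λ i t 0≡t → ≡.subst (_< ℓ i) (ℤP.+-injective 0≡t) (1≤ℓ i)))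
  first-equation -[1+ n ] = ≡.cong₂ ℚ._+_
    (≡.cong (λ x → 1ℚ ℚ.* 0ℚ ℚ.+ (x ℚ.+ 0ℚ)) (ℚP.*-zeroʳ (-ℚ ((+ q) / 1))))
    (GenP∑-short -[1+ n ] (λ _ _ ()))
  first-equation (+ suc n) = begin
    (1ℚ ℚ.* A′ ℚ.+ ((-ℚ c) ℚ.* A ℚ.+ 0ℚ)) ℚ.+ sumS (map GenP (allFin k)) (+ suc n)
      ≡⟨ ≡.cong ((1ℚ ℚ.* A′ ℚ.+ ((-ℚ c) ℚ.* A ℚ.+ 0ℚ)) ℚ.+_)
                (≡.trans (sumS-coeff GenP (allFin k) (+ suc n)) (≡.sym (ι-∑ (λ i → endCount i (suc n)) (allFin k)))) ⟩
    (1ℚ ℚ.* A′ ℚ.+ ((-ℚ c) ℚ.* A ℚ.+ 0ℚ)) ℚ.+ T′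
      ≡⟨ rearrange A′ A c T′ ⟩
    (A′ ℚ.+ T′) ℚ.- c ℚ.* A
      ≡⟨ ≡.cong (ℚ._- c ℚ.* A) (begin
           A′ ℚ.+ T′                                                      ≡⟨ ι-+ (avoidCount (suc n)) _ ⟨
           ι (avoidCount (suc n) + ∑ (λ i → endCount i (suc n)) (allFin k)) ≡⟨ ≡.cong ι (recurrence₁ n) ⟩
           ι (q * avoidCount n)                                           ≡⟨ ι-* q (avoidCount n) ⟩
           c ℚ.* A                                                        ∎) ⟩
    c ℚ.* A ℚ.- c ℚ.* A
      ≡⟨ ℚP.+-inverseʳ (c ℚ.* A) ⟩
    0ℚ ∎
    where
    open ≡.≡-Reasoning
    open import Data.Rational.Solver using (module +-*-Solver)
    open +-*-Solver
    c = (+ q) / 1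
    A = ι (avoidCount n)
    A′ = ι (avoidCount (suc n))
    T′ = ι (∑ (λ i → endCount i (suc n)) (allFin k))
    rearrange : ∀ a′ a c t → (1ℚ ℚ.* a′ ℚ.+ ((-ℚ c) ℚ.* a ℚ.+ 0ℚ)) ℚ.+ t ≡ (a′ ℚ.+ t) ℚ.- c ℚ.* a
    rearrange = solve 4 (λ a′ a c t → (con 1ℚ :* a′ :+ ((:- c) :* a :+ con 0ℚ)) :+ t := (a′ :+ t) :+ (:- (c :* a)))
                        ≡.refl

  correlationSeries : Fin k → Fin k → Ser
  correlationSeries j i = recip (orbitSize (ps i)) ⋆ zpow (- (+ ℓ i)) (polyMul (corr (ps i) (ps j)) (GenP i))

  correlationSeries-coeff : ∀ j i z → correlationSeries j i z ≡
    recip (orbitSize (ps i)) ℚ.* ℚ∑.∑< (ℓ i) (λ s → corrCoeff (ps i) (ps j) s ℚ.* GenP i ((z ℤ.- - (+ ℓ i)) ℤ.- + s))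
  correlationSeries-coeff j i z = ≡.cong (recip (orbitSize (ps i)) ℚ.*_)
    (polyMul-coeff (corrCoeff (ps i) (ps j)) id (ℓ i) (GenP i) (z ℤ.- - (+ ℓ i)))

  -- |G| · r_i⁻¹ · C_s = |G| · (|G_p| / |G|) · (|G_x| / |G_p|) = |G_x|
  order-scaled-corrCoeff : ∀ j i s →
    ι order ℚ.* (recip (orbitSize (ps i)) ℚ.* corrCoeff (ps i) (ps j) s) ≡ ι (correlationCount j i s)
  order-scaled-corrCoeff j i s with drop s (ps i) ∼? take (ℓ i ∸ s) (ps j)
  ... | yes _ = ≡.trans (frac-cancel order (stab (drop s (ps i))) (stab (ps i)) order-positive (stab-positive (ps i)))
                        (≡.cong ι (≡.sym (ℕP.+-identityʳ (stab (drop s (ps i))))))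
  ... | no _  = ≡.trans (≡.cong (ι order ℚ.*_) (ℚP.*-zeroʳ (recip (orbitSize (ps i))))) (ℚP.*-zeroʳ (ι order))

  order-scaled-correlationSeries : ∀ j i n → ι order ℚ.* correlationSeries j i (+ n) ≡
    ι (∑[ s < ℓ i ] (correlationCount j i s * endCount i (n + (ℓ i ∸ s))))
  order-scaled-correlationSeries j i n = begin
    ι order ℚ.* correlationSeries j i (+ n)
      ≡⟨ ≡.cong (ι order ℚ.*_)
                (≡.trans (correlationSeries-coeff j i (+ n)) (≡.sym (ℚ∑.∑<-*ˡ r (λ s → C s ℚ.* P s) (ℓ i)))) ⟩
    ι order ℚ.* ℚ∑.∑< (ℓ i) (λ s → r ℚ.* (C s ℚ.* P s))
      ≡⟨ ℚ∑.∑<-*ˡ (ι order) (λ s → r ℚ.* (C s ℚ.* P s)) (ℓ i) ⟨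
    ℚ∑.∑< (ℓ i) (λ s → ι order ℚ.* (r ℚ.* (C s ℚ.* P s)))
      ≡⟨ ℚ∑.∑<-cong (ℓ i) (λ s s<ℓᵢ → term s (ℕP.<⇒≤ s<ℓᵢ)) ⟩
    ℚ∑.∑< (ℓ i) (λ s → ι (correlationCount j i s * endCount i (n + (ℓ i ∸ s))))
      ≡⟨ ι-∑< (λ s → correlationCount j i s * endCount i (n + (ℓ i ∸ s))) (ℓ i) ⟨
    ι (∑[ s < ℓ i ] (correlationCount j i s * endCount i (n + (ℓ i ∸ s)))) ∎
    where
    open ≡.≡-Reasoning
    open import Data.Rational.Solver using (module +-*-Solver)
    open +-*-Solver
    r = recip (orbitSize (ps i))
    C = corrCoeff (ps i) (ps j)
    P : ℕ → ℚ
    P s = GenP i ((+ n ℤ.- - (+ ℓ i)) ℤ.- + s)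
    reassociate : ∀ g r c p → g ℚ.* (r ℚ.* (c ℚ.* p)) ≡ (g ℚ.* (r ℚ.* c)) ℚ.* p
    reassociate = solve 4 (λ g r c p → g :* (r :* (c :* p)) := (g :* (r :* c)) :* p) ≡.refl
    term : ∀ s → s ≤ ℓ i →
           ι order ℚ.* (r ℚ.* (C s ℚ.* P s)) ≡ ι (correlationCount j i s * endCount i (n + (ℓ i ∸ s)))
    term s s≤ℓᵢ = begin
      ι order ℚ.* (r ℚ.* (C s ℚ.* P s))
        ≡⟨ reassociate (ι order) r (C s) (P s) ⟩
      (ι order ℚ.* (r ℚ.* C s)) ℚ.* P s
        ≡⟨ ≡.cong₂ ℚ._*_ (order-scaled-corrCoeff j i s) (≡.cong (GenP i) (shifted-index n (ℓ i) s s≤ℓᵢ)) ⟩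
      ι (correlationCount j i s) ℚ.* ι (endCount i (n + (ℓ i ∸ s)))
        ≡⟨ ι-* (correlationCount j i s) _ ⟨
      ι (correlationCount j i s * endCount i (n + (ℓ i ∸ s))) ∎

  second-equation : ∀ j → (GenS ⊖ sumS (map (correlationSeries j) (allFin k))) ≈S (λ _ → 0ℚ)
  second-equation j (+ n) = ≡.trans
    (≡.cong (ℚ._-_ (ι (avoidCount n))) (≡.trans (sumS-coeff (correlationSeries j) (allFin k) (+ n))
                                             (ι-cancelˡ order order-positive scaled)))
    (ℚP.+-inverseʳ (ι (avoidCount n)))
    where
    open ≡.≡-Reasoning
    scaled : ι order ℚ.* ℚ∑.∑ (λ i → correlationSeries j i (+ n)) (allFin k) ≡ ι order ℚ.* ι (avoidCount n)
    scaled = begin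
      ι order ℚ.* ℚ∑.∑ (λ i → correlationSeries j i (+ n)) (allFin k)
        ≡⟨ ℚ∑.∑-*ˡ (ι order) (λ i → correlationSeries j i (+ n)) (allFin k) ⟨
      ℚ∑.∑ (λ i → ι order ℚ.* correlationSeries j i (+ n)) (allFin k)
        ≡⟨ ℚ∑.∑-cong (allFin k) (λ i → order-scaled-correlationSeries j i n) ⟩
      ℚ∑.∑ (λ i → ι (∑[ s < ℓ i ] (correlationCount j i s * endCount i (n + (ℓ i ∸ s))))) (allFin k)
        ≡⟨ ι-∑ (λ i → ∑[ s < ℓ i ] (correlationCount j i s * endCount i (n + (ℓ i ∸ s)))) (allFin k) ⟨
      ι (∑ (λ i → ∑[ s < ℓ i ] (correlationCount j i s * endCount i (n + (ℓ i ∸ s)))) (allFin k))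
        ≡⟨ ≡.cong ι (recurrence₂ j n) ⟨
      ι (order * avoidCount n)
        ≡⟨ ι-* order (avoidCount n) ⟩
      ι order ℚ.* ι (avoidCount n) ∎
  second-equation j -[1+ d ] = ≡.cong (ℚ._-_ 0ℚ)
    (≡.trans (sumS-coeff (correlationSeries j) (allFin k) -[1+ d ])
             (≡.trans (ℚ∑.∑-cong (allFin k) vanishes) (ℚ∑.∑-zero (allFin k))))
    where
    vanishes : ∀ i → correlationSeries j i -[1+ d ] ≡ 0ℚ
    vanishes i = ≡.trans (correlationSeries-coeff j i -[1+ d ]) (≡.trans
      (≡.cong (recip (orbitSize (ps i)) ℚ.*_) (≡.trans
        (ℚ∑.∑<-cong (ℓ i) (λ s _ → ≡.trans
          (≡.cong (corrCoeff (ps i) (ps j) s ℚ.*_) (GenP-short i _ (shifted-index-negative d (ℓ i) s)))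
          (ℚP.*-zeroʳ (corrCoeff (ps i) (ps j) s))))
        (ℚ∑.∑<-zero (ℓ i))))
      (ℚP.*-zeroʳ (recip (orbitSize (ps i)))))

mainTheorem1 : (q : ℕ) → 2 ≤ q → (G : Subgroup q) →
    let open WithGroup G in
    (k : ℕ) (ps : Fin k → Word q) →
    let open WithPatterns ps in
    (∀ i → IsPattern (ps i)) → (∀ i → 1 ≤ ℓ i) → Distinct → Reduced →
    ((polyMul (1ℚ ∷ (-ℚ ((+ q) / 1)) ∷ []) GenS ⊕ sumS (map GenP (allFin k))) ≈S oneS)
    × (∀ j → (GenS ⊖ sumS (map (λ i → recip (orbitSize (ps i))
                  ⋆ zpow (- (+ ℓ i)) (polyMul (corr (ps i) (ps j)) (GenP i)))
                  (allFin k))) ≈S (λ _ → 0ℚ))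
mainTheorem1 q _ G k ps _ 1≤ℓ _ reduced = first-equation , second-equation
  where open Series G ps 1≤ℓ reduced
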